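{- Let $G$ be a finite cubic graph and let $v,w$ be distinct vertices of $G$. Then all vertex degrees in the Hamilton incidence multigraph $H(G,v,w)$ have the same parity.
   Context: Graphs are simple; a cubic graph has all vertex degrees equal to $3$. For a vertex $u$, $E(u)$ is the set of edges incident with $u$, and $[E(u)]^2$ is the set of $2$-element subsets of $E(u)$. For distinct vertices $v,w$ of $G$, the Hamilton incidence multigraph $H=H(G,v,w)$ is the bipartite multigraph with vertex set the disjoint union $[E(v)]^2 \sqcup [E(w)]^2$, in which for $p\in[E(v)]^2$ and $q\in[E(w)]^2$ the number of edges between $p$ and $q$ equals the number of Hamilton cycles $D$ of $G$ with $p\cup q\subseteq E(D)$ (and there are no other edges). Degrees in $H$ count edges with multiplicity. -}

module Defs where

open import Data.Nat using (ℕ; zero; suc; _≤_; _<ᵇ_)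
open import Data.Bool using (Bool; true; false; _∧_)
open import Data.Fin using (Fin; toℕ)
import Data.Fin as F
open import Data.List using (List; []; _∷_; map; concatMap; length; filter; filterᵇ; allFin; cartesianProduct; _++_)
open import Data.Nat.ListAction using (sum)
open import Data.Product using (_×_; _,_; Σ; ∃-syntax)
open import Data.Sum using (_⊎_)
open import Relation.Binary.PropositionalEquality using (_≡_)
open import Relation.Nullary using (Dec)
open import Relation.Nullary.Decidable using (_×-dec_)
open import Relation.Unary using (Decidable)
open import Data.Bool.Properties using (_≟_)
open import Function.Definitions using (Injective)

record SimpleGraph (n : ℕ) : Set where
  field
    adj    : Fin n → Fin n → Bool
    sym    : ∀ i j → adj i j ≡ adj j i
    irrefl : ∀ i → adj i i ≡ false
open SimpleGraph public

degree : ∀ {n} → SimpleGraph n → Fin n → ℕ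
degree {n} G u = length (filterᵇ (adj G u) (allFin n))

Cubic : ∀ {n} → SimpleGraph n → Set
Cubic {n} G = ∀ u → degree G u ≡ 3

-- An edge subset of G is represented by a Boolean relation D on vertices;
-- D x y ≡ true means that the edge {x,y} belongs to the subset.
EdgeRel : ℕ → Set
EdgeRel n = Fin n → Fin n → Bool

CyclicSucc : ∀ n → Fin n → Fin n → Set
CyclicSucc n i j = (suc (toℕ i) ≡ toℕ j) ⊎ ((suc (toℕ i) ≡ n) × (toℕ j ≡ 0))

IsHamCycle : ∀ {n} → SimpleGraph n → EdgeRel n → Set
IsHamCycle {n} G D =
  (3 ≤ n) ×
  (∀ x y → D x y ≡ true → adj G x y ≡ true) ×
  Σ (Fin n → Fin n) λ σ → Injective _≡_ _≡_ σ ×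
    (∀ x y → (D x y ≡ true) →
        ∃[ i ] ∃[ j ] (CyclicSucc n i j × (((σ i ≡ x) × (σ j ≡ y)) ⊎ ((σ i ≡ y) × (σ j ≡ x))))) ×
    (∀ i j → CyclicSucc n i j → D (σ i) (σ j) ≡ true × D (σ j) (σ i) ≡ true)

allFuns : ∀ {A : Set} k → List A → List (Fin k → A)
allFuns zero    xs = (λ ()) ∷ []
allFuns (suc k) xs =
  concatMap (λ a → map (λ f → cons a f) (allFuns k xs)) xs
  where
    cons : _ → (Fin _ → _) → Fin (suc _) → _
    cons a f F.zero    = a
    cons a f (F.suc i) = f i

allEdgeRels : ∀ n → List (EdgeRel n)
allEdgeRels n = allFuns n (allFuns n (true ∷ false ∷ []))

-- [E(u)]^2: a 2-subset {{u,a},{u,b}} of edges at u is listed once, as (a , b)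
-- with toℕ a < toℕ b and a, b neighbours of u.
edgePairs : ∀ {n} → SimpleGraph n → Fin n → List (Fin n × Fin n)
edgePairs {n} G u =
  filterᵇ (λ { (a , b) → adj G u a ∧ adj G u b ∧ (toℕ a <ᵇ toℕ b) })
          (cartesianProduct (allFin n) (allFin n))

module Hamilton {n : ℕ} (G : SimpleGraph n) (v w : Fin n)
                (hc? : ∀ D → Dec (IsHamCycle G D)) where

  -- number of Hamilton cycles D of G with p ∪ q ⊆ E(D), where
  -- p = {{v,a},{v,b}} and q = {{w,c},{w,d}}.  (The value does not depend on
  -- the decision procedure hc?.)
  mult : Fin n × Fin n → Fin n × Fin n → ℕ
  mult (a , b) (c , d) =
    length (filter
      (λ D → hc? D ×-dec (D v a ≟ true) ×-dec (D v b ≟ true)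
                   ×-dec (D w c ≟ true) ×-dec (D w d ≟ true))
      (allEdgeRels n))

  degV : Fin n × Fin n → ℕ
  degV p = sum (map (mult p) (edgePairs G w))

  degW : Fin n × Fin n → ℕ
  degW q = sum (map (λ p → mult p q) (edgePairs G v))

  hDegrees : List ℕ
  hDegrees = map degV (edgePairs G v) ++ map degW (edgePairs G w)

module Submission where

-- A Hamilton cycle passes through a vertex along exactly one pair of its edges, so the degree
-- of p ∈ [E(v)]² in H is the number of Hamilton cycles using both edges of p (and likewise at w).
-- Since v has degree 3, these are the Hamilton cycles avoiding the third edge e at v, and by
-- Smith's theorem e lies on an even number of Hamilton cycles. So every degree is congruent
-- mod 2 to the total number of Hamilton cycles. Smith's theorem is proved by Thomason's lollipop
-- argument: each Hamilton path starting along the edge ux ends at a vertex with two further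
-- neighbours, giving an even number of markedSequences; Pósa rotation pairs up those whose chord does
-- not return to u, and the remaining ones are the Hamilton cycles through ux.

open import Defs hiding (sym)
open import Level using (0ℓ)
open import Data.Bool using (Bool; true; false; T?; _∧_)
import Data.Bool.Properties as Bool
open import Data.Empty using (⊥; ⊥-elim)
open import Data.Fin using (Fin; zero; suc; toℕ; fromℕ; fromℕ<; inject₁; opposite)
import Data.Fin as Fin
open import Data.Fin.Properties
  using (toℕ-injective; toℕ<n; toℕ-fromℕ; toℕ-fromℕ<; toℕ-inject₁; toℕ-lower₁; opposite-prop; opposite-involutive; any?)
open import Data.List
  using (List; []; _∷_; _++_; _∷ʳ_; [_]; map; concat; filter; length; reverse; head; tabulate; allFin; cartesianProduct)
open import Data.List.Properties
  using ( length-map; length-filter; length-removeAt′; length-tabulate; length-++; length-reverse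
        ; ∷-injectiveˡ; ∷-injectiveʳ; unfold-reverse; reverse-++; reverse-involutive; ++-assoc; ++-cancelˡ)
open import Data.List.Membership.Propositional using (_∈_; _∉_)
import Data.List.Membership.Propositional as Membership
open import Data.List.Membership.Propositional.Properties
  using ( ∈-allFin; ∈-tabulate⁻; ∈-∃++; ∈-++⁺ʳ; ∈-++⁻; ∈-cartesianProduct⁺; ∈-cartesianProduct⁻
        ; ∈-filter⁻; ∈-filter⁺; ∈-map⁺; ∈-map⁻; ∈-concat⁻′; ∈-concat⁺′)
import Data.List.Membership.DecPropositional as DecMembership
import Data.List.Membership.Setoid as SetoidMembership
import Data.List.Membership.Setoid.Properties as SetoidMembershipₚ
open import Data.List.Relation.Unary.All as All using (All; []; _∷_)
open import Data.List.Relation.Unary.All.Properties as All using (All¬⇒¬Any)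
open import Data.List.Relation.Unary.AllPairs as AllPairs using (AllPairs; []; _∷_)
import Data.List.Relation.Unary.AllPairs.Properties as AllPairs
open import Data.List.Relation.Unary.Any as Any using (Any; here; there; _─_)
import Data.List.Relation.Unary.Any.Properties as Any
open import Data.List.Relation.Unary.Linked as Linked using (Linked; []; [-]; _∷_)
open import Data.List.Relation.Unary.Unique.Propositional using (Unique)
import Data.List.Relation.Unary.Unique.Propositional.Properties as Unique
import Data.List.Relation.Unary.Unique.Setoid as SetoidUnique
open import Data.Maybe using (just)
import Data.Maybe.Properties as Maybe
open import Data.Nat using (ℕ; zero; suc; _+_; _*_; _∸_; _≤_; _<_; z≤n; s≤s; _%_; _<ᵇ_)
open import Data.Nat.DivMod using ([m+kn]%n≡m%n)
open import Data.Nat.GeneralisedArithmetic using (fold)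
open import Data.Nat.ListAction using (sum)
import Data.Nat.Properties as ℕ
open import Algebra.Properties.CommutativeSemigroup ℕ.+-commutativeSemigroup using (interchange; x∙yz≈y∙xz)
open import Data.Nat.Properties
  using (+-assoc; +-comm; +-suc; +-identityʳ; *-comm; suc-injective; ≤-refl; ≤-trans; ≤-antisym; n≤1+n; <-irrefl)
open import Data.Product using (_×_; _,_; proj₁; proj₂; ∃-syntax)
import Data.Product
open import Data.Sum using (_⊎_; inj₁; inj₂)
import Data.Sum
open import Data.Vec.Functional.Relation.Binary.Pointwise using (Pointwise)
open import Function using (_∘_; Equivalence; _⇔_; mk⇔)
open import Function.Definitions using (Injective)
open import Relation.Binary.Bundles using (Setoid)
open import Relation.Binary.Definitions using (tri<; tri≈; tri>)
open import Relation.Binary.PropositionalEquality hiding ([_])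
open import Relation.Nullary using (¬_; Dec; yes; no; does)
open import Relation.Nullary.Decidable using (_×-dec_; _⊎-dec_; ¬?)
open import Relation.Unary using (Decidable)

private variable
  A B : Set

indicator : ∀ {X : Set} → Dec X → ℕ
indicator (yes _) = 1
indicator (no _)  = 0

indicator-yes : ∀ {X : Set} (d : Dec X) → X → indicator d ≡ 1
indicator-yes (yes _) _ = refl
indicator-yes (no ¬x) x = ⊥-elim (¬x x)

indicator-yes-× : ∀ {X Y : Set} (x : X) (d : Dec Y) → indicator (yes x ×-dec d) ≡ indicator d
indicator-yes-× x (yes _) = refl
indicator-yes-× x (no _)  = refl

count : {P : A → Set} → Decidable P → List A → ℕ
count P? []       = 0
count P? (x ∷ xs) = indicator (P? x) + count P? xs

module _ {P : A → Set} (P? : Decidable P) where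

  length-filter≡count : ∀ xs → length (filter P? xs) ≡ count P? xs
  length-filter≡count [] = refl
  length-filter≡count (x ∷ xs) with P? x
  ... | yes _ = cong suc (length-filter≡count xs)
  ... | no _  = length-filter≡count xs

  count-++ : ∀ xs ys → count P? (xs ++ ys) ≡ count P? xs + count P? ys
  count-++ []       ys = refl
  count-++ (x ∷ xs) ys = trans (cong (indicator (P? x) +_) (count-++ xs ys)) (sym (+-assoc (indicator (P? x)) _ _))

  count-map : ∀ (f : B → A) xs → count P? (map f xs) ≡ count (P? ∘ f) xs
  count-map f []       = refl
  count-map f (x ∷ xs) = cong (indicator (P? (f x)) +_) (count-map f xs)

  count-split : ∀ {Q : A → Set} (Q? : Decidable Q) xs →
    count P? xs ≡ count (λ x → P? x ×-dec Q? x) xs + count (λ x → P? x ×-dec ¬? (Q? x)) xs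
  count-split Q? [] = refl
  count-split Q? (x ∷ xs) with P? x | Q? x
  ... | yes _ | yes _ = cong suc (count-split Q? xs)
  ... | yes _ | no _  = trans (cong suc (count-split Q? xs)) (sym (+-suc _ _))
  ... | no _  | yes _ = count-split Q? xs
  ... | no _  | no _  = count-split Q? xs

  count≡0 : ∀ xs → (∀ x → x ∈ xs → ¬ P x) → count P? xs ≡ 0
  count≡0 []       _ = refl
  count≡0 (x ∷ xs) h with P? x
  ... | yes p = ⊥-elim (h x (here refl) p)
  ... | no _  = count≡0 xs (λ y y∈ → h y (there y∈))

  count≡1 : ∀ {x} xs → Unique xs → x ∈ xs → P x → (∀ y → y ∈ xs → P y → y ≡ x) → count P? xs ≡ 1
  count≡1 (y ∷ xs) (y∉ ∷ _) (here refl) px only with P? y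
  ... | yes _ = cong suc (count≡0 xs (λ z z∈ pz → All¬⇒¬Any y∉ (subst (_∈ xs) (only z (there z∈) pz) z∈)))
  ... | no ¬py = ⊥-elim (¬py px)
  count≡1 (y ∷ xs) (y∉ ∷ u) (there x∈) px only with P? y
  ... | yes py = ⊥-elim (All¬⇒¬Any y∉ (subst (_∈ xs) (sym (only y (here refl) py)) x∈))
  ... | no _   = count≡1 xs u x∈ px (λ z z∈ → only z (there z∈))

  count-─ : ∀ {x xs} (x∈ : x ∈ xs) → count P? xs ≡ indicator (P? x) + count P? (xs ─ x∈)
  count-─ (here refl) = refl
  count-─ {x} {y ∷ xs} (there x∈) =
    trans (cong (indicator (P? y) +_) (count-─ x∈)) (x∙yz≈y∙xz (indicator (P? y)) (indicator (P? x)) _)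

count-cong : ∀ {P Q : A → Set} (P? : Decidable P) (Q? : Decidable Q) xs →
  (∀ x → x ∈ xs → (P x → Q x) × (Q x → P x)) → count P? xs ≡ count Q? xs
count-cong P? Q? [] h = refl
count-cong P? Q? (x ∷ xs) h with P? x | Q? x | h x (here refl)
... | yes _ | yes _ | _       = cong suc (count-cong P? Q? xs (λ y y∈ → h y (there y∈)))
... | no _  | no _  | _       = count-cong P? Q? xs (λ y y∈ → h y (there y∈))
... | yes p | no ¬q | (f , _) = ⊥-elim (¬q (f p))
... | no ¬p | yes q | (_ , g) = ⊥-elim (¬p (g q))

count-cartesianProduct : ∀ {P : A × B → Set} (P? : Decidable P) xs ys →
  count P? (cartesianProduct xs ys) ≡ sum (map (λ x → count (λ y → P? (x , y)) ys) xs)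
count-cartesianProduct P? []       ys = refl
count-cartesianProduct P? (x ∷ xs) ys =
  trans (count-++ P? (map (x ,_) ys) (cartesianProduct xs ys))
        (cong₂ _+_ (count-map P? (x ,_) ys) (count-cartesianProduct P? xs ys))

sum-map-cong : ∀ (f g : A → ℕ) xs → (∀ x → x ∈ xs → f x ≡ g x) → sum (map f xs) ≡ sum (map g xs)
sum-map-cong f g []       h = refl
sum-map-cong f g (x ∷ xs) h = cong₂ _+_ (h x (here refl)) (sum-map-cong f g xs (λ y y∈ → h y (there y∈)))

sum-map-+ : ∀ (f g : A → ℕ) xs → sum (map (λ x → f x + g x) xs) ≡ sum (map f xs) + sum (map g xs)
sum-map-+ f g []       = refl
sum-map-+ f g (x ∷ xs) =
  trans (cong (f x + g x +_) (sum-map-+ f g xs)) (interchange (f x) (g x) (sum (map f xs)) (sum (map g xs)))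

sum-map-indicator : ∀ {P : A → Set} (P? : Decidable P) xs → sum (map (indicator ∘ P?) xs) ≡ count P? xs
sum-map-indicator P? []       = refl
sum-map-indicator P? (x ∷ xs) = cong (indicator (P? x) +_) (sum-map-indicator P? xs)

double-counting : ∀ {P : A → Set} {R : B → A → Set} (P? : Decidable P) (R? : ∀ q → Decidable (R q)) xs qs →
  (∀ D → D ∈ xs → P D → count (λ q → R? q D) qs ≡ 1) →
  sum (map (λ q → count (λ D → P? D ×-dec R? q D) xs) qs) ≡ count P? xs
double-counting P? R? [] qs h = sum-zero qs
  where
  sum-zero : ∀ qs → sum (map (λ _ → 0) qs) ≡ 0
  sum-zero []       = refl
  sum-zero (_ ∷ qs) = sum-zero qs
double-counting P? R? (D ∷ xs) qs h =
  trans (sum-map-+ (λ q → indicator (P? D ×-dec R? q D)) (λ q → count (λ D → P? D ×-dec R? q D) xs) qs)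
        (cong₂ _+_ (head-term (P? D) (h D (here refl))) (double-counting P? R? xs qs (λ D' D'∈ → h D' (there D'∈))))
  where
  head-term : (d : Dec _) → (_ → count (λ q → R? q D) qs ≡ 1) →
              sum (map (λ q → indicator (d ×-dec R? q D)) qs) ≡ indicator d
  head-term (yes p) one =
    trans (sum-map-cong _ _ qs (λ q _ → indicator-yes-× p (R? q D)))
          (trans (sum-map-indicator (λ q → R? q D) qs) (one p))
  head-term (no ¬p) _   =
    trans (sum-map-indicator (λ q → no ¬p ×-dec R? q D) qs) (count≡0 _ qs (λ _ _ r → ¬p (proj₁ r)))

AllPairs-mapWith∈ : ∀ {R R′ : A → A → Set} xs → (∀ {a b} → a ∈ xs → b ∈ xs → R a b → R′ a b) →
  AllPairs R xs → AllPairs R′ xs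
AllPairs-mapWith∈ []       h []       = []
AllPairs-mapWith∈ (x ∷ xs) h (r ∷ rs) =
  All.tabulate (λ b∈ → h (here refl) (there b∈) (All.lookup r b∈)) ∷
  AllPairs-mapWith∈ xs (λ a∈ b∈ → h (there a∈) (there b∈)) rs

module _ (S : Setoid 0ℓ 0ℓ) where
  open Setoid S using (Carrier; _≈_) renaming (sym to ≈-sym; trans to ≈-trans)
  open SetoidMembership S using () renaming (_∈_ to _∈ₛ_)
  open SetoidUnique S using () renaming (Unique to Uniqueₛ)

  ∈ₛ-─⁺ : ∀ {x y zs} (x∈ : x ∈ₛ zs) → y ∈ₛ zs → ¬ y ≈ x → y ∈ₛ (zs ─ x∈)
  ∈ₛ-─⁺ (here x≈z) (here y≈z) y≉x = ⊥-elim (y≉x (≈-trans y≈z (≈-sym x≈z)))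
  ∈ₛ-─⁺ (here _)   (there y∈) _   = y∈
  ∈ₛ-─⁺ (there _)  (here y≈z) _   = here y≈z
  ∈ₛ-─⁺ (there x∈) (there y∈) y≉x = there (∈ₛ-─⁺ x∈ y∈ y≉x)

  unique-⊆⇒length≤ : ∀ xs ys → Uniqueₛ xs → All (_∈ₛ ys) xs → length xs ≤ length ys
  unique-⊆⇒length≤ []       ys _          _            = z≤n
  unique-⊆⇒length≤ (x ∷ xs) ys (x≉ ∷ uxs) (x∈ ∷ xs⊆ys) =
    subst (suc (length xs) ≤_) (sym (length-removeAt′ ys (Any.index x∈)))
      (s≤s (unique-⊆⇒length≤ xs (ys ─ x∈) uxs (All.zipWith (λ (y∈ , x≉y) → ∈ₛ-─⁺ x∈ y∈ (x≉y ∘ ≈-sym)) (xs⊆ys , x≉))))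

  count-≡-of-bijection : ∀ {P : A → Set} {Q : Carrier → Set} (P? : Decidable P) (Q? : Decidable Q)
    (xs : List A) (ys : List Carrier) (f : A → Carrier) →
    Unique xs → Uniqueₛ ys → (∀ {y y′} → y ≈ y′ → Q y → Q y′) → (∀ y → y ∈ₛ ys) →
    (∀ x → x ∈ xs → P x → Q (f x)) →
    (∀ x x′ → x ∈ xs → x′ ∈ xs → P x → P x′ → f x ≈ f x′ → x ≡ x′) →
    (∀ y → y ∈ ys → Q y → ∃[ x ] x ∈ xs × P x × f x ≈ y) →
    count P? xs ≡ count Q? ys
  count-≡-of-bijection {P = P} P? Q? xs ys f uxs uys Q-resp ys-complete f-Q f-inj f-surj =
    subst₂ _≡_ (trans (length-map f (filter P? xs)) (length-filter≡count P? xs)) (length-filter≡count Q? ys)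
      (≤-antisym (unique-⊆⇒length≤ image (filter Q? ys) image-unique image⊆)
                 (unique-⊆⇒length≤ (filter Q? ys) image (AllPairs.filter⁺ Q? uys) ⊆image))
    where
    image : List Carrier
    image = map f (filter P? xs)

    image-unique : Uniqueₛ image
    image-unique = AllPairs.map⁺ (AllPairs-mapWith∈ (filter P? xs)
      (λ a∈ b∈ a≢b fa≈fb → let (a∈xs , pa) = ∈-filter⁻ P? a∈ ; (b∈xs , pb) = ∈-filter⁻ P? b∈ in
                            a≢b (f-inj _ _ a∈xs b∈xs pa pb fa≈fb))
      (AllPairs.filter⁺ P? uxs))

    image⊆ : All (_∈ₛ filter Q? ys) image
    image⊆ = All.map⁺ (All.tabulate λ x∈ → let (x∈xs , px) = ∈-filter⁻ P? x∈ in
      SetoidMembershipₚ.∈-filter⁺ S Q? Q-resp (ys-complete (f _)) (f-Q _ x∈xs px))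

    ⊆image : All (_∈ₛ image) (filter Q? ys)
    ⊆image = All.tabulate λ y∈ → let (y∈ys , qy) = ∈-filter⁻ Q? y∈ ; (x , x∈ , px , fx≈y) = f-surj _ y∈ys qy in
      Any.map (λ { refl → ≈-sym fx≈y }) (∈-map⁺ f (∈-filter⁺ P? x∈ px))

∈-─⁻ : ∀ {x y : A} {zs} (x∈ : x ∈ zs) → y ∈ (zs ─ x∈) → y ∈ zs
∈-─⁻ (here _)   y∈         = there y∈
∈-─⁻ (there _)  (here y≡z) = here y≡z
∈-─⁻ (there x∈) (there y∈) = there (∈-─⁻ x∈ y∈)

∈-─⇒≢ : ∀ {x y : A} {zs} (x∈ : x ∈ zs) → Unique zs → y ∈ (zs ─ x∈) → y ≢ x
∈-─⇒≢ (here refl) (x∉ ∷ _) y∈         refl = All¬⇒¬Any x∉ y∈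
∈-─⇒≢ (there x∈)  (z∉ ∷ _) (here refl) refl = All¬⇒¬Any z∉ x∈
∈-─⇒≢ (there x∈)  (_ ∷ u)  (there y∈)      = ∈-─⇒≢ x∈ u y∈

unique-─ : ∀ {x : A} {zs} (x∈ : x ∈ zs) → Unique zs → Unique (zs ─ x∈)
unique-─ (here _)   (_ ∷ u)    = u
unique-─ (there x∈) (z∉ ∷ u) = All.─⁺ x∈ z∉ ∷ unique-─ x∈ u

Even : ℕ → Set
Even n = ∃[ k ] n ≡ k + k

even-difference : ∀ a b c → a + b ≡ c + c → Even b → Even a
even-difference a _ c a+b≡c+c (d , refl) = go c d a+b≡c+c
  where
  2+ : ∀ m → suc m + suc m ≡ suc (suc (m + m))
  2+ m = cong suc (+-suc m m)
  go : ∀ c d → a + (d + d) ≡ c + c → Even a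
  go c       zero    e = c , trans (sym (+-identityʳ a)) e
  go zero    (suc d) e = ⊥-elim (ℕ.0≢1+n (sym (trans (sym (+-suc a (d + suc d))) e)))
  go (suc c) (suc d) e = go c d (suc-injective (suc-injective (begin
    suc (suc (a + (d + d)))  ≡⟨ sym (trans (cong (a +_) (2+ d)) (trans (+-suc a _) (cong suc (+-suc a _)))) ⟩
    a + (suc d + suc d)      ≡⟨ e ⟩
    suc c + suc c            ≡⟨ 2+ c ⟩
    suc (suc (c + c))        ∎)))
    where open ≡-Reasoning

FreeInvolutionOn : (A → Set) → (A → A) → List A → Set
FreeInvolutionOn P f xs = ∀ x → x ∈ xs → P x → f x ∈ xs × P (f x) × f (f x) ≡ x × f x ≢ x

module _ {P : A → Set} (P? : Decidable P) (f : A → A) where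

  private
    on-tail : ∀ {x xs} → ¬ P x → FreeInvolutionOn P f (x ∷ xs) → FreeInvolutionOn P f xs
    on-tail ¬px inv y y∈ py with inv y (there y∈) py
    ... | here fy≡x , pfy , _ = ⊥-elim (¬px (subst P fy≡x pfy))
    ... | there fy∈ , rest    = fy∈ , rest

    on-removal : ∀ {x xs} → Unique (x ∷ xs) → (fx∈ : f x ∈ xs) → f (f x) ≡ x →
                 FreeInvolutionOn P f (x ∷ xs) → FreeInvolutionOn P f (xs ─ fx∈)
    on-removal {x} {xs} (x∉ ∷ u) fx∈ ffx≡x inv y y∈ py with inv y (there (∈-─⁻ fx∈ y∈)) py
    ... | here fy≡x , _ , ffy≡y , _ =
      ⊥-elim (∈-─⇒≢ fx∈ u y∈ (trans (sym ffy≡y) (cong f fy≡x)))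
    ... | there fy∈ , pfy , ffy≡y , fy≢y = ∈ₛ-─⁺ (setoid A) fx∈ fy∈ fy≢fx , pfy , ffy≡y , fy≢y
      where
      fy≢fx : f y ≢ f x
      fy≢fx fy≡fx = All¬⇒¬Any x∉ (subst (_∈ xs) (trans (sym ffy≡y) (trans (cong f fy≡fx) ffx≡x)) (∈-─⁻ fx∈ y∈))

    count-even-bounded : ∀ n xs → length xs ≤ n → Unique xs → FreeInvolutionOn P f xs → Even (count P? xs)
    count-even-bounded _       []       _         _         _   = 0 , refl
    count-even-bounded (suc n) (x ∷ xs) (s≤s len) (x∉ ∷ u) inv with P? x
    ... | no ¬px = count-even-bounded n xs len u (on-tail ¬px inv)
    ... | yes px with inv x (here refl) px
    ...   | here fx≡x , _ , _ , fx≢x = ⊥-elim (fx≢x fx≡x)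
    ...   | there fx∈ , pfx , ffx≡x , _ with count-even-bounded n (xs ─ fx∈) len′ (unique-─ fx∈ u) (on-removal (x∉ ∷ u) fx∈ ffx≡x inv)
      where
      len′ : length (xs ─ fx∈) ≤ n
      len′ = ≤-trans (n≤1+n _) (subst (_≤ n) (length-removeAt′ xs (Any.index fx∈)) len)
    ...     | k , eq = suc k , cong suc (begin
      count P? xs                                   ≡⟨ count-─ P? fx∈ ⟩
      indicator (P? (f x)) + count P? (xs ─ fx∈)   ≡⟨ cong₂ _+_ (indicator-yes (P? (f x)) pfx) eq ⟩
      suc (k + k)                                   ≡⟨ sym (+-suc k k) ⟩
      k + suc k                                     ∎)
      where open ≡-Reasoning

  count-even-of-involution : ∀ xs → Unique xs → FreeInvolutionOn P f xs → Even (count P? xs)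
  count-even-of-involution xs = count-even-bounded (length xs) xs ≤-refl

module _ (R : A → A → Set) where

  allFuns-complete : ∀ k (xs : List A) → (∀ a → Any (R a) xs) → ∀ (g : Fin k → A) → Any (Pointwise R g) (allFuns k xs)
  allFuns-complete zero    xs complete g = here (λ ())
  allFuns-complete (suc k) xs complete g =
    Any.concat⁺ (Any.map⁺ (Any.map (λ r → Any.map⁺ (Any.map (λ { pw zero → r ; pw (suc i) → pw i })
      (allFuns-complete k xs complete (g ∘ suc)))) (complete (g zero))))

  private
    head∈ : ∀ {k} (cons : A → (Fin k → A) → Fin (suc k) → A) → (∀ a g → cons a g zero ≡ a) →
      (gs : List (Fin k → A)) (ys : List A) (g : Fin (suc k) → A) →
      g ∈ concat (map (λ a → map (cons a) gs) ys) → g zero ∈ ys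
    head∈ cons cons-zero gs ys g g∈ with ∈-concat⁻′ (map _ ys) g∈
    ... | zs , g∈zs , zs∈ with ∈-map⁻ _ zs∈
    ...   | a , a∈ , refl with ∈-map⁻ _ g∈zs
    ...     | h , _ , refl = subst (_∈ ys) (sym (cons-zero a h)) a∈

    unique-conses : ∀ {k} (cons : A → (Fin k → A) → Fin (suc k) → A) →
      (∀ a g → cons a g zero ≡ a) → (∀ a g i → cons a g (suc i) ≡ g i) →
      (gs : List (Fin k → A)) → AllPairs (λ g h → ¬ Pointwise R g h) gs →
      ∀ ys → AllPairs (λ a b → ¬ R a b) ys →
      AllPairs (λ g h → ¬ Pointwise R g h) (concat (map (λ a → map (cons a) gs) ys))
    unique-conses cons cons-zero cons-suc gs ugs []       _          = []
    unique-conses cons cons-zero cons-suc gs ugs (a ∷ ys) (a≉ ∷ uys) =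
      AllPairs.++⁺
        (AllPairs.map⁺ (AllPairs.map (λ {g} {h} ¬pw pw → ¬pw (λ i → subst₂ R (cons-suc a g i) (cons-suc a h i) (pw (suc i)))) ugs))
        (unique-conses cons cons-zero cons-suc gs ugs ys uys)
        (All.tabulate λ g∈ → All.tabulate λ h∈ pw → heads-differ g∈ h∈ pw)
      where
      heads-differ : ∀ {g h} → g ∈ map (cons a) gs → h ∈ concat (map (λ a → map (cons a) gs) ys) → ¬ Pointwise R g h
      heads-differ {h = h} g∈ h∈ pw with ∈-map⁻ _ g∈
      ... | g′ , _ , refl =
        All.lookup a≉ (head∈ cons cons-zero gs ys h h∈) (subst (λ z → R z (h zero)) (cons-zero a g′) (pw zero))

  allFuns-unique : ∀ k (xs : List A) → AllPairs (λ a b → ¬ R a b) xs →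
    AllPairs (λ g h → ¬ Pointwise R g h) (allFuns k xs)
  allFuns-unique zero    xs _   = [] ∷ []
  allFuns-unique (suc k) xs uxs =
    unique-conses _ (λ _ _ → refl) (λ _ _ _ → refl) (allFuns k xs) (allFuns-unique k xs uxs) xs uxs

module _ {A : Set} where

  allLists : ℕ → List A → List (List A)
  allLists zero    xs = [] ∷ []
  allLists (suc m) xs = concat (map (λ a → map (a ∷_) (allLists m xs)) xs)

  allLists-length : ∀ m xs {l} → l ∈ allLists m xs → length l ≡ m
  allLists-length zero    xs (here refl) = refl
  allLists-length (suc m) xs l∈ with ∈-concat⁻′ (map _ xs) l∈
  ... | ls , l∈ls , ls∈ with ∈-map⁻ _ ls∈
  ...   | a , a∈ , refl with ∈-map⁻ _ l∈ls
  ...     | l′ , l′∈ , refl = cong suc (allLists-length m xs l′∈)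

  allLists-complete : ∀ m xs l → length l ≡ m → All (_∈ xs) l → l ∈ allLists m xs
  allLists-complete zero    xs []      _   _          = here refl
  allLists-complete (suc m) xs (a ∷ l) len (a∈ ∷ l⊆) =
    ∈-concat⁺′ (∈-map⁺ (a ∷_) (allLists-complete m xs l (suc-injective len) l⊆))
               (∈-map⁺ (λ a → map (a ∷_) (allLists m xs)) a∈)

  allLists-unique : ∀ m xs → Unique xs → Unique (allLists m xs)
  allLists-unique zero    xs _   = [] ∷ []
  allLists-unique (suc m) xs uxs = conses xs uxs
    where
    head∈ : ∀ ys {l} → l ∈ concat (map (λ a → map (a ∷_) (allLists m xs)) ys) → ∃[ a ] ∃[ r ] l ≡ a ∷ r × a ∈ ys
    head∈ ys l∈ with ∈-concat⁻′ (map _ ys) l∈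
    ... | ls , l∈ls , ls∈ with ∈-map⁻ _ ls∈
    ...   | a , a∈ , refl with ∈-map⁻ _ l∈ls
    ...     | r , _ , refl = a , r , refl , a∈

    conses : ∀ ys → Unique ys → Unique (concat (map (λ a → map (a ∷_) (allLists m xs)) ys))
    conses []       _          = []
    conses (a ∷ ys) (a∉ ∷ uys) =
      AllPairs.++⁺ (AllPairs.map⁺ (AllPairs.map (λ r≢r′ e → r≢r′ (∷-injectiveʳ e)) (allLists-unique m xs uxs)))
                   (conses ys uys)
                   (All.tabulate λ l∈ → All.tabulate λ l′∈ → heads-differ l∈ l′∈)
      where
      heads-differ : ∀ {l l′} → l ∈ map (a ∷_) (allLists m xs) →
                     l′ ∈ concat (map (λ a → map (a ∷_) (allLists m xs)) ys) → l ≢ l′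
      heads-differ l∈ l′∈ e with ∈-map⁻ _ l∈ | head∈ ys l′∈
      ... | _ , _ , refl | b , _ , refl , b∈ = All¬⇒¬Any a∉ (subst (_∈ ys) (sym (∷-injectiveˡ e)) b∈)

  ∷-∷ʳ-view : ∀ (a : A) ws → ∃[ r ] ∃[ e ] a ∷ ws ≡ r ∷ʳ e
  ∷-∷ʳ-view a []       = [] , a , refl
  ∷-∷ʳ-view a (w ∷ ws) with ∷-∷ʳ-view w ws
  ... | r , e , eq = a ∷ r , e , cong (a ∷_) eq

  head-++-∷ : ∀ pre (z : A) P Q → head (pre ++ z ∷ P) ≡ head (pre ++ z ∷ Q)
  head-++-∷ []      z P Q = refl
  head-++-∷ (_ ∷ _) z P Q = refl

  lastTwo : A → A → List A → A × A
  lastTwo a b []      = a , b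
  lastTwo a b (c ∷ l) = lastTwo b c l

  lastTwo-++ : ∀ a b xs c d → lastTwo a b (xs ++ c ∷ d ∷ []) ≡ (c , d)
  lastTwo-++ a b []       c d = refl
  lastTwo-++ a b (x ∷ xs) c d = lastTwo-++ b x xs c d

  lastTwo-∷ʳ : ∀ a b xs e → proj₂ (lastTwo a b (xs ∷ʳ e)) ≡ e
  lastTwo-∷ʳ a b []       e = refl
  lastTwo-∷ʳ a b (x ∷ xs) e = lastTwo-∷ʳ b x xs e

  -- entries past the end of the list read as d
  nth : A → List A → ℕ → A
  nth d []      _       = d
  nth d (a ∷ l) zero    = a
  nth d (a ∷ l) (suc t) = nth d l t

  lastTwo≡nth : ∀ d a b l {m} → length l ≡ m → lastTwo a b l ≡ (nth d (a ∷ b ∷ l) m , nth d (a ∷ b ∷ l) (suc m))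
  lastTwo≡nth d a b []      refl = refl
  lastTwo≡nth d a b (c ∷ l) refl = lastTwo≡nth d b c l refl

  nth-∈ : ∀ d ws t → t < length ws → nth d ws t ∈ ws
  nth-∈ d (a ∷ ws) zero    _         = here refl
  nth-∈ d (a ∷ ws) (suc t) (s≤s lt) = there (nth-∈ d ws t lt)

  nth-injective : ∀ d ws t t′ → Unique ws → t < length ws → t′ < length ws → nth d ws t ≡ nth d ws t′ → t ≡ t′
  nth-injective d (a ∷ ws) zero    zero     _          _        _         _ = refl
  nth-injective d (a ∷ ws) zero    (suc t′) (a∉ ∷ _) _        (s≤s lt′) e = ⊥-elim (All¬⇒¬Any a∉ (subst (_∈ ws) (sym e) (nth-∈ d ws t′ lt′)))
  nth-injective d (a ∷ ws) (suc t) zero     (a∉ ∷ _) (s≤s lt) _         e = ⊥-elim (All¬⇒¬Any a∉ (subst (_∈ ws) e (nth-∈ d ws t lt)))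
  nth-injective d (a ∷ ws) (suc t) (suc t′) (_ ∷ u)  (s≤s lt) (s≤s lt′) e = cong suc (nth-injective d ws t t′ u lt lt′ e)

  nth-ext : ∀ d xs ys → length xs ≡ length ys → (∀ t → t < length xs → nth d xs t ≡ nth d ys t) → xs ≡ ys
  nth-ext d []       []       _   _ = refl
  nth-ext d (x ∷ xs) (y ∷ ys) len h = cong₂ _∷_ (h zero (s≤s z≤n)) (nth-ext d xs ys (suc-injective len) (λ t lt → h (suc t) (s≤s lt)))

  unique-++⁻ : ∀ (xs : List A) {ys} → Unique (xs ++ ys) → Unique xs × Unique ys × All (λ a → All (a ≢_) ys) xs
  unique-++⁻ []       u          = [] , u , []
  unique-++⁻ (x ∷ xs) (x∉ ∷ u) with unique-++⁻ xs u | All.++⁻ {P = x ≢_} xs x∉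
  ... | uxs , uys , disjoint | x∉xs , x∉ys = (x∉xs ∷ uxs) , uys , (x∉ys ∷ disjoint)

  unique-reverse : ∀ (ys : List A) → Unique ys → Unique (reverse ys)
  unique-reverse []       _        = []
  unique-reverse (y ∷ ys) (y∉ ∷ u) = subst Unique (sym (unfold-reverse y ys))
    (AllPairs.++⁺ (unique-reverse ys u) ([] ∷ [])
      (All.tabulate (λ a∈ → (λ a≡y → All¬⇒¬Any y∉ (subst (_∈ ys) a≡y (Any.reverse⁻ a∈))) ∷ [])))

  unique-++-reverse : ∀ (xs ys : List A) → Unique (xs ++ ys) → Unique (xs ++ reverse ys)
  unique-++-reverse xs ys u with unique-++⁻ xs u
  ... | uxs , uys , disjoint =
    AllPairs.++⁺ uxs (unique-reverse ys uys) (All.map (λ x∉ → All.tabulate (All.lookup x∉ ∘ Any.reverse⁻)) disjoint)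

  unique-middle : ∀ (pre : List A) {z} rest → Unique (pre ++ z ∷ rest) → z ∉ pre × z ∉ rest
  unique-middle pre rest u with unique-++⁻ pre u
  ... | _ , (z∉ ∷ _) , disjoint = (λ z∈ → All.lookup (All.lookup disjoint z∈) (here refl) refl) , All¬⇒¬Any z∉

  module _ {R : A → A → Set} where

    Linked-++⁻ʳ : ∀ xs {ys} → Linked R (xs ++ ys) → Linked R ys
    Linked-++⁻ʳ []       c = c
    Linked-++⁻ʳ (x ∷ xs) c = Linked-++⁻ʳ xs (Linked.tail c)

    Linked-∷ʳ⁻ : ∀ xs {y} ys → Linked R (xs ++ y ∷ ys) → Linked R (xs ∷ʳ y)
    Linked-∷ʳ⁻ []            ys _       = [-]
    Linked-∷ʳ⁻ (x ∷ [])      [] (r ∷ _) = r ∷ [-]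
    Linked-∷ʳ⁻ (x ∷ [])  (_ ∷ _) (r ∷ _) = r ∷ [-]
    Linked-∷ʳ⁻ (x ∷ x′ ∷ xs) ys (r ∷ c) = r ∷ Linked-∷ʳ⁻ (x′ ∷ xs) ys c

    Linked-join : ∀ xs {y w ws} → Linked R (xs ∷ʳ y) → R y w → Linked R (w ∷ ws) → Linked R (xs ++ y ∷ w ∷ ws)
    Linked-join []            _       r c′ = r ∷ c′
    Linked-join (x ∷ [])      (r₀ ∷ _) r c′ = r₀ ∷ r ∷ c′
    Linked-join (x ∷ x′ ∷ xs) (r₀ ∷ c) r c′ = r₀ ∷ Linked-join (x′ ∷ xs) c r c′

    Linked-reverse : (∀ {a b} → R a b → R b a) → ∀ {l} → Linked R l → Linked R (reverse l)
    Linked-reverse sym-R []                = []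
    Linked-reverse sym-R [-]               = [-]
    Linked-reverse sym-R {a ∷ b ∷ l} (r ∷ c) =
      subst (Linked R) (sym (reverse-++ (a ∷ b ∷ []) l))
        (Linked-join (reverse l) (subst (Linked R) (unfold-reverse b l) (Linked-reverse sym-R c)) (sym-R r) [-])

    Linked-nth : ∀ d ws t → Linked R ws → suc t < length ws → R (nth d ws t) (nth d ws (suc t))
    Linked-nth d (a ∷ b ∷ ws) zero    (r ∷ _) _          = r
    Linked-nth d (a ∷ b ∷ ws) (suc t) (_ ∷ c) (s≤s lt) = Linked-nth d (b ∷ ws) t c lt
    Linked-nth d (a ∷ [])     _       [-]     (s≤s ())

    nth⇒Linked : ∀ d ws → (∀ t → suc t < length ws → R (nth d ws t) (nth d ws (suc t))) → Linked R ws
    nth⇒Linked d []           h = []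
    nth⇒Linked d (a ∷ [])     h = [-]
    nth⇒Linked d (a ∷ b ∷ ws) h = h zero (s≤s (s≤s z≤n)) ∷ nth⇒Linked d (b ∷ ws) (λ t lt → h (suc t) (s≤s lt))

  module _ (_≟_ : (a b : A) → Dec (a ≡ b)) where

    reverseAfter : A → List A → List A
    reverseAfter z []      = []
    reverseAfter z (a ∷ l) with a ≟ z
    ... | yes _ = a ∷ reverse l
    ... | no _  = a ∷ reverseAfter z l

    reverseAfter-++ : ∀ z pre rest → z ∉ pre → reverseAfter z (pre ++ z ∷ rest) ≡ pre ++ z ∷ reverse rest
    reverseAfter-++ z [] rest _ with z ≟ z
    ... | yes _ = refl
    ... | no z≢z = ⊥-elim (z≢z refl)
    reverseAfter-++ z (a ∷ pre) rest z∉ with a ≟ z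
    ... | yes a≡z = ⊥-elim (z∉ (here (sym a≡z)))
    ... | no _    = cong (a ∷_) (reverseAfter-++ z pre rest (z∉ ∘ there))

unique-full⇒∈ : ∀ {n} (ws : List (Fin n)) → Unique ws → length ws ≡ n → ∀ y → y ∈ ws
unique-full⇒∈ {n} ws uws len y with DecMembership._∈?_ Fin._≟_ y ws
... | yes y∈ = y∈
... | no y∉  = ⊥-elim (<-irrefl refl (subst₂ _≤_ (cong suc len) (length-tabulate (λ i → i))
    (unique-⊆⇒length≤ (setoid _) (y ∷ ws) (allFin n)
       (All.tabulate (λ w∈ y≡w → y∉ (subst (_∈ ws) (sym y≡w) w∈)) ∷ uws)
       (All.tabulate (λ {w} _ → ∈-allFin w)))))

injective⇒surjective : ∀ {n} (σ : Fin n → Fin n) → Injective _≡_ _≡_ σ → ∀ a → ∃[ i ] σ i ≡ a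
injective⇒surjective σ σ-inj a with ∈-tabulate⁻ (unique-full⇒∈ (tabulate σ) (Unique.tabulate⁺ σ-inj) (length-tabulate σ) a)
... | i , a≡σi = i , sym a≡σi

-- The cyclic order on Fin (suc k)

module _ {k : ℕ} where

  next : Fin (suc k) → Fin (suc k)
  next i with toℕ i ℕ.≟ k
  ... | yes _   = zero
  ... | no i≢k  = suc (Fin.lower₁ i (i≢k ∘ sym))

  prev : Fin (suc k) → Fin (suc k)
  prev zero    = fromℕ k
  prev (suc j) = inject₁ j

  next-cases : ∀ i → (toℕ i ≡ k × next i ≡ zero) ⊎ (toℕ i < k × toℕ (next i) ≡ suc (toℕ i))
  next-cases i with toℕ i ℕ.≟ k
  ... | yes i≡k = inj₁ (i≡k , refl)
  ... | no i≢k  = inj₂ (ℕ.≤∧≢⇒< (ℕ.≤-pred (toℕ<n i)) i≢k , cong suc (toℕ-lower₁ i (i≢k ∘ sym)))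

  prev-cases : ∀ i → (i ≡ zero × toℕ (prev i) ≡ k) ⊎ (∃[ t ] toℕ i ≡ suc t × toℕ (prev i) ≡ t)
  prev-cases zero    = inj₁ (refl , toℕ-fromℕ k)
  prev-cases (suc j) = inj₂ (toℕ j , refl , toℕ-inject₁ j)

  next-prev : ∀ i → next (prev i) ≡ i
  next-prev i with prev-cases i | next-cases (prev i)
  ... | inj₁ (refl , _)   | inj₁ (_ , next≡0) = next≡0
  ... | inj₁ (_ , p≡k)    | inj₂ (p<k , _)    = ⊥-elim (<-irrefl p≡k p<k)
  ... | inj₂ (t , i≡1+t , p≡t) | inj₁ (p≡k , _) =
    ⊥-elim (<-irrefl (trans (sym p≡t) p≡k) (ℕ.≤-pred (subst (_< suc k) i≡1+t (toℕ<n i))))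
  ... | inj₂ (t , i≡1+t , p≡t) | inj₂ (_ , n≡1+p) = toℕ-injective (trans n≡1+p (trans (cong suc p≡t) (sym i≡1+t)))

  prev-next : ∀ i → prev (next i) ≡ i
  prev-next i with next-cases i
  ... | inj₁ (i≡k , n≡0) rewrite n≡0 = toℕ-injective (trans (toℕ-fromℕ k) (sym i≡k))
  ... | inj₂ (_ , n≡1+i) with prev-cases (next i)
  ...   | inj₁ (n≡0 , _)        = ⊥-elim (ℕ.0≢1+n (trans (sym (cong toℕ n≡0)) n≡1+i))
  ...   | inj₂ (t , n≡1+t , p≡t) = toℕ-injective (trans p≡t (suc-injective (trans (sym n≡1+t) n≡1+i)))

  next-injective : Injective _≡_ _≡_ next
  next-injective {x} {y} e = trans (sym (prev-next x)) (trans (cong prev e) (prev-next y))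

  next→CyclicSucc : ∀ i → CyclicSucc (suc k) i (next i)
  next→CyclicSucc i with next-cases i
  ... | inj₁ (i≡k , n≡0) = inj₂ (cong suc i≡k , cong toℕ n≡0)
  ... | inj₂ (_ , n≡1+i) = inj₁ (sym n≡1+i)

  CyclicSucc→next : ∀ {i j} → CyclicSucc (suc k) i j → j ≡ next i
  CyclicSucc→next {i} {j} (inj₁ 1+i≡j) with next-cases i
  ... | inj₁ (i≡k , _)   = ⊥-elim (<-irrefl (trans (sym 1+i≡j) (cong suc i≡k)) (toℕ<n j))
  ... | inj₂ (_ , n≡1+i) = toℕ-injective (trans (sym 1+i≡j) (sym n≡1+i))
  CyclicSucc→next {i} {j} (inj₂ (1+i≡1+k , j≡0)) with next-cases i
  ... | inj₁ (_ , n≡0) = toℕ-injective (trans j≡0 (sym (cong toℕ n≡0)))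
  ... | inj₂ (i<k , _) = ⊥-elim (<-irrefl (suc-injective 1+i≡1+k) i<k)

  next²≢id : 2 ≤ k → ∀ i → next (next i) ≢ i
  next²≢id 2≤k i nni≡i with next-cases i
  ... | inj₁ (i≡k , n≡0) with next-cases (next i)
  ...   | inj₁ (ni≡k , _)  = <-irrefl (trans (sym (cong toℕ n≡0)) ni≡k) (≤-trans (s≤s z≤n) 2≤k)
  ...   | inj₂ (_ , nn≡1+n) = <-irrefl (trans (sym (trans nn≡1+n (cong (suc ∘ toℕ) n≡0))) (trans (cong toℕ nni≡i) i≡k)) 2≤k
  next²≢id 2≤k i nni≡i | inj₂ (_ , n≡1+i) with next-cases (next i)
  ... | inj₁ (ni≡k , nn≡0) = <-irrefl (trans (sym (trans n≡1+i (cong suc (trans (sym (cong toℕ nni≡i)) (cong toℕ nn≡0))))) ni≡k) 2≤k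
  ... | inj₂ (_ , nn≡1+n) = ℕ.m≢1+n+m (toℕ i) (trans (sym (cong toℕ nni≡i)) (trans nn≡1+n (cong suc n≡1+i)))

  rotate : ℕ → Fin (suc k) → Fin (suc k)
  rotate t i = fold i next t

  toℕ-rotate-zero : ∀ t → t ≤ k → toℕ (rotate t zero) ≡ t
  toℕ-rotate-zero zero    _     = refl
  toℕ-rotate-zero (suc t) 1+t≤k with next-cases (rotate t zero)
  ... | inj₁ (r≡k , _)   = ⊥-elim (<-irrefl (trans (sym (toℕ-rotate-zero t (ℕ.<⇒≤ 1+t≤k))) r≡k) 1+t≤k)
  ... | inj₂ (_ , n≡1+r) = trans n≡1+r (cong suc (toℕ-rotate-zero t (ℕ.<⇒≤ 1+t≤k)))

  rotate-toℕ-zero : ∀ i → rotate (toℕ i) zero ≡ i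
  rotate-toℕ-zero i = toℕ-injective (toℕ-rotate-zero (toℕ i) (ℕ.≤-pred (toℕ<n i)))

  rotate-next : ∀ t j → rotate t (next j) ≡ next (rotate t j)
  rotate-next zero    j = refl
  rotate-next (suc t) j = cong next (rotate-next t j)

  rotate-injective : ∀ t → Injective _≡_ _≡_ (rotate t)
  rotate-injective zero    e = e
  rotate-injective (suc t) e = rotate-injective t (next-injective e)

  reflect : Fin (suc k) → Fin (suc k)
  reflect i = next (opposite i)

  opposite-next : ∀ i → opposite (next i) ≡ prev (opposite i)
  opposite-next i with next-cases i
  ... | inj₁ (i≡k , n≡0) rewrite n≡0 =
    toℕ-injective (trans (toℕ-fromℕ k) (sym (trans (cong (toℕ ∘ prev) opposite≡0) (toℕ-fromℕ k))))
    where
    opposite≡0 : opposite i ≡ zero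
    opposite≡0 = toℕ-injective (trans (opposite-prop i) (trans (cong (k ∸_) i≡k) (ℕ.n∸n≡0 k)))
  ... | inj₂ (i<k , n≡1+i) with prev-cases (opposite i)
  ...   | inj₁ (o≡0 , _) = ⊥-elim (ℕ.0≢1+n (sym (trans (sym (trans (opposite-prop i) (ℕ.+-∸-assoc 1 i<k))) (cong toℕ o≡0))))
  ...   | inj₂ (t , o≡1+t , p≡t) = toℕ-injective (begin
    toℕ (opposite (next i))  ≡⟨ opposite-prop (next i) ⟩
    k ∸ toℕ (next i)         ≡⟨ cong (k ∸_) n≡1+i ⟩
    k ∸ suc (toℕ i)          ≡⟨ suc-injective (trans (sym (ℕ.+-∸-assoc 1 i<k)) (trans (sym (opposite-prop i)) o≡1+t)) ⟩
    t                        ≡⟨ sym p≡t ⟩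
    toℕ (prev (opposite i))  ∎)
    where open ≡-Reasoning

  reflect-zero : reflect zero ≡ zero
  reflect-zero = next-prev zero

  reflect-next : ∀ j → reflect (next j) ≡ prev (reflect j)
  reflect-next j = trans (cong next (opposite-next j)) (trans (next-prev (opposite j)) (sym (prev-next (opposite j))))

  reflect-injective : Injective _≡_ _≡_ reflect
  reflect-injective {x} {y} e = trans (sym (opposite-involutive x)) (trans (cong opposite (next-injective e)) (opposite-involutive y))

  AdjacentIn : (Fin (suc k) → Fin (suc k)) → Fin (suc k) → Fin (suc k) → Set
  AdjacentIn ρ a b = ∃[ i ] ρ i ≡ a × (ρ (next i) ≡ b ⊎ ρ (prev i) ≡ b)

  AdjacentIn-at : ∀ {ρ} → Injective _≡_ _≡_ ρ → ∀ {j a y} → ρ j ≡ a → AdjacentIn ρ a y → ρ (next j) ≡ y ⊎ ρ (prev j) ≡ y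
  AdjacentIn-at ρ-inj ρj≡a (i , ρi≡a , adj) with ρ-inj (trans ρi≡a (sym ρj≡a))
  ... | refl = adj

  IsCycleSymmetry : (Fin (suc k) → Fin (suc k)) → Set
  IsCycleSymmetry h = (∀ j → h (next j) ≡ next (h j)) ⊎ (∀ j → h (next j) ≡ prev (h j))

  rotate-symmetry : ∀ t → IsCycleSymmetry (rotate t)
  rotate-symmetry t = inj₁ (rotate-next t)

  reflect-symmetry : IsCycleSymmetry reflect
  reflect-symmetry = inj₂ reflect-next

  module _ {h : Fin (suc k) → Fin (suc k)} (h-inj : Injective _≡_ _≡_ h) (h-sym : IsCycleSymmetry h) (ρ : Fin (suc k) → Fin (suc k)) where

    private
      next-or-prev : ∀ j → (h (next j) ≡ next (h j) × h (prev j) ≡ prev (h j)) ⊎ (h (next j) ≡ prev (h j) × h (prev j) ≡ next (h j))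
      next-or-prev j = Data.Sum.map
        (λ h-next → h-next j , trans (sym (prev-next _)) (cong prev (trans (sym (h-next (prev j))) (cong h (next-prev j)))))
        (λ h-next → h-next j , trans (sym (next-prev _)) (cong next (trans (sym (h-next (prev j))) (cong h (next-prev j)))))
        h-sym

    AdjacentIn-∘⁺ : ∀ {a b} → AdjacentIn ρ a b → AdjacentIn (ρ ∘ h) a b
    AdjacentIn-∘⁺ (i , ρi≡a , adj) with injective⇒surjective h h-inj i
    ... | j , refl with next-or-prev j
    ...   | inj₁ (n , p) = j , ρi≡a , Data.Sum.map (trans (cong ρ n)) (trans (cong ρ p)) adj
    ...   | inj₂ (n , p) = j , ρi≡a , Data.Sum.swap (Data.Sum.map (trans (cong ρ p)) (trans (cong ρ n)) adj)

    AdjacentIn-∘⁻ : ∀ {a b} → AdjacentIn (ρ ∘ h) a b → AdjacentIn ρ a b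
    AdjacentIn-∘⁻ (j , ρhj≡a , adj) with next-or-prev j
    ... | inj₁ (n , p) = h j , ρhj≡a , Data.Sum.map (trans (cong ρ (sym n))) (trans (cong ρ (sym p))) adj
    ... | inj₂ (n , p) = h j , ρhj≡a , Data.Sum.swap (Data.Sum.map (trans (cong ρ (sym n))) (trans (cong ρ (sym p))) adj)

module _ {k : ℕ} where

  Traverses : EdgeRel (suc k) → (Fin (suc k) → Fin (suc k)) → Set
  Traverses D ρ = Injective _≡_ _≡_ ρ × (∀ a b → D a b ≡ true → AdjacentIn ρ a b) × (∀ a b → AdjacentIn ρ a b → D a b ≡ true)

  Traverses-∘ : ∀ {D ρ h} → Injective _≡_ _≡_ h → IsCycleSymmetry h → Traverses D ρ → Traverses D (ρ ∘ h)
  Traverses-∘ h-inj h-sym (ρ-inj , D⇒adj , adj⇒D) =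
    h-inj ∘ ρ-inj , (λ a b d → AdjacentIn-∘⁺ h-inj h-sym _ (D⇒adj a b d)) , (λ a b adj → adj⇒D a b (AdjacentIn-∘⁻ h-inj h-sym _ adj))

  traversal : ∀ {G : SimpleGraph (suc k)} {D} → IsHamCycle G D → ∃[ σ ] Traverses D σ
  traversal {D = D} (_ , _ , σ , σ-inj , D⇒succ , succ⇒D) = σ , σ-inj , D⇒adj , adj⇒D
    where
    D⇒adj : ∀ a b → D a b ≡ true → AdjacentIn σ a b
    D⇒adj a b d with D⇒succ a b d
    ... | i , j , succ , inj₁ (σi≡a , σj≡b) = i , σi≡a , inj₁ (trans (cong σ (sym (CyclicSucc→next succ))) σj≡b)
    ... | i , j , succ , inj₂ (σi≡b , σj≡a) = j , σj≡a , inj₂ (trans (cong σ (trans (cong prev (CyclicSucc→next succ)) (prev-next i))) σi≡b)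
    adj⇒D : ∀ a b → AdjacentIn σ a b → D a b ≡ true
    adj⇒D _ _ (i , refl , inj₁ refl) = proj₁ (succ⇒D i (next i) (next→CyclicSucc i))
    adj⇒D _ _ (i , refl , inj₂ refl) =
      subst (λ j → D (σ j) (σ (prev i)) ≡ true) (next-prev i) (proj₂ (succ⇒D (prev i) _ (next→CyclicSucc (prev i))))

  module _ {G : SimpleGraph (suc k)} {D : EdgeRel (suc k)} (hc : IsHamCycle G D) where

    traversal-from : ∀ a → ∃[ ρ ] Traverses D ρ × ρ zero ≡ a
    traversal-from a with traversal {G = G} hc
    ... | σ , σ-trav@(σ-inj , _) with injective⇒surjective σ σ-inj a
    ...   | i , σi≡a = σ ∘ rotate (toℕ i) , Traverses-∘ (rotate-injective (toℕ i)) (rotate-symmetry (toℕ i)) σ-trav ,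
                       trans (cong σ (rotate-toℕ-zero i)) σi≡a

    traversal-along : ∀ a b → D a b ≡ true → ∃[ ρ ] Traverses D ρ × ρ zero ≡ a × ρ (next zero) ≡ b
    traversal-along a b dab with traversal-from a
    ... | ρ , ρ-trav@(ρ-inj , D⇒adj , _) , ρ0≡a with AdjacentIn-at ρ-inj ρ0≡a (D⇒adj a b dab)
    ...   | inj₁ ρ1≡b = ρ , ρ-trav , ρ0≡a , ρ1≡b
    ...   | inj₂ ρ₋₁≡b = ρ ∘ reflect , Traverses-∘ reflect-injective reflect-symmetry ρ-trav ,
                         trans (cong ρ reflect-zero) ρ0≡a ,
                         trans (cong ρ (trans (reflect-next zero) (cong prev reflect-zero))) ρ₋₁≡b

    two-neighbours : 2 ≤ k → ∀ a →
      ∃[ y₁ ] ∃[ y₂ ] y₁ ≢ y₂ × D a y₁ ≡ true × D a y₂ ≡ true × (∀ y → D a y ≡ true → y ≡ y₁ ⊎ y ≡ y₂)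
    two-neighbours 2≤k a with traversal-from a
    ... | ρ , (ρ-inj , D⇒adj , adj⇒D) , ρ0≡a =
      ρ (next zero) , ρ (prev zero) ,
      (λ e → next²≢id 2≤k zero (trans (cong next (ρ-inj e)) (next-prev zero))) ,
      adj⇒D a _ (zero , ρ0≡a , inj₁ refl) , adj⇒D a _ (zero , ρ0≡a , inj₂ refl) ,
      (λ y d → Data.Sum.map sym sym (AdjacentIn-at ρ-inj ρ0≡a (D⇒adj a y d)))

-- Thomason's lollipop argument

module Lollipops {k : ℕ} (G : SimpleGraph (suc k)) (cubic : Cubic G) (2≤k : 2 ≤ k) (u x : Fin (suc k)) where

  Adj : Fin (suc k) → Fin (suc k) → Set
  Adj a b = adj G a b ≡ true

  Adj? : ∀ a b → Dec (Adj a b)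
  Adj? a b = adj G a b Bool.≟ true

  Adj-sym : ∀ {a b} → Adj a b → Adj b a
  Adj-sym {a} {b} = trans (SimpleGraph.sym G b a)

  -- A list l stands for the walk u, l₀, l₁, …; it is a path if it starts with
  -- the edge ux and visits no vertex twice.
  IsPath : List (Fin (suc k)) → Set
  IsPath l = Unique (u ∷ l) × Linked Adj (u ∷ l) × head l ≡ just x

  IsPath? : ∀ l → Dec (IsPath l)
  IsPath? l = AllPairs.allPairs? (λ a b → ¬? (a Fin.≟ b)) (u ∷ l) ×-dec Linked.linked? Adj? (u ∷ l) ×-dec Maybe.≡-dec Fin._≟_ (head l) (just x)

  end penultimate : List (Fin (suc k)) → Fin (suc k)
  end         l = proj₂ (lastTwo u u l)
  penultimate l = proj₁ (lastTwo u u l)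

  Lollipop : List (Fin (suc k)) × Fin (suc k) → Set
  Lollipop (l , z) = IsPath l × Adj (end l) z × z ≢ penultimate l

  Lollipop? : ∀ p → Dec (Lollipop p)
  Lollipop? (l , z) = IsPath? l ×-dec Adj? (end l) z ×-dec ¬? (z Fin.≟ penultimate l)

  Closable : List (Fin (suc k)) → Set
  Closable l = Lollipop (l , u)

  Closable? : ∀ l → Dec (Closable l)
  Closable? l = Lollipop? (l , u)

  OpenLollipop : List (Fin (suc k)) × Fin (suc k) → Set
  OpenLollipop p = Lollipop p × proj₂ p ≢ u

  OpenLollipop? : ∀ p → Dec (OpenLollipop p)
  OpenLollipop? p = Lollipop? p ×-dec ¬? (proj₂ p Fin.≟ u)

  -- Hamilton sequences have k vertices after u.
  sequences : List (List (Fin (suc k)))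
  sequences = allLists k (allFin (suc k))

  markedSequences : List (List (Fin (suc k)) × Fin (suc k))
  markedSequences = cartesianProduct sequences (allFin (suc k))

  ∈-sequences : ∀ l → length l ≡ k → l ∈ sequences
  ∈-sequences l len = allLists-complete k (allFin (suc k)) l len (All.tabulate (λ {w} _ → ∈-allFin w))

  ∈-sequences⇒length : ∀ {l} → l ∈ sequences → length l ≡ k
  ∈-sequences⇒length = allLists-length k (allFin (suc k))

  -- Pósa rotation: the chord end–z is kept and the edge from z to its successor is dropped.
  posa : List (Fin (suc k)) × Fin (suc k) → List (Fin (suc k)) × Fin (suc k)
  posa (l , z) = reverseAfter Fin._≟_ z l , z

  private module Rotation (pre : List (Fin (suc k))) (z y y₂ : Fin (suc k)) (r₂ : List (Fin (suc k))) where
    rest l l′ : List (Fin (suc k))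
    rest = y ∷ y₂ ∷ r₂
    l    = pre ++ z ∷ rest
    l′   = pre ++ z ∷ reverse rest

    r : List (Fin (suc k))
    r = proj₁ (∷-∷ʳ-view y (y₂ ∷ r₂))

    e : Fin (suc k)
    e = proj₁ (proj₂ (∷-∷ʳ-view y (y₂ ∷ r₂)))

    rest≡r∷ʳe : rest ≡ r ∷ʳ e
    rest≡r∷ʳe = proj₂ (proj₂ (∷-∷ʳ-view y (y₂ ∷ r₂)))

    reverse-rest : reverse rest ≡ e ∷ reverse r
    reverse-rest = trans (cong reverse rest≡r∷ʳe) (reverse-++ r [ e ])

    length-l′ : length l′ ≡ length l
    length-l′ = trans (length-++ pre) (trans (cong (λ m → length pre + suc m) (length-reverse rest)) (sym (length-++ pre)))

    end-l : end l ≡ e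
    end-l = trans (cong (λ w → end (pre ++ z ∷ w)) rest≡r∷ʳe)
                  (trans (cong end (sym (++-assoc pre (z ∷ r) [ e ]))) (lastTwo-∷ʳ u u (pre ++ z ∷ r) e))

    lastTwo-l′ : lastTwo u u l′ ≡ (y₂ , y)
    lastTwo-l′ = trans (cong (λ w → lastTwo u u (pre ++ z ∷ w)) (reverse-++ (y ∷ y₂ ∷ []) r₂))
                       (trans (cong (lastTwo u u) (sym (++-assoc pre (z ∷ reverse r₂) (y₂ ∷ y ∷ []))))
                              (lastTwo-++ u u (pre ++ z ∷ reverse r₂) y₂ y))

    unique-l′ : Unique (u ∷ l) → Unique (u ∷ l′)
    unique-l′ ul = subst Unique (sym (regroup (reverse rest))) (unique-++-reverse (u ∷ pre ∷ʳ z) rest (subst Unique (regroup rest) ul))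
      where
      regroup : ∀ w → u ∷ pre ++ z ∷ w ≡ (u ∷ pre ∷ʳ z) ++ w
      regroup w = cong (u ∷_) (sym (++-assoc pre [ z ] w))

    linked-l′ : Linked Adj (u ∷ l) → Adj (end l) z → Linked Adj (u ∷ l′)
    linked-l′ c end-z = subst (λ w → Linked Adj (u ∷ pre ++ z ∷ w)) (sym reverse-rest)
      (Linked-join (u ∷ pre) (Linked-∷ʳ⁻ (u ∷ pre) rest c) (Adj-sym (subst (λ w → Adj w z) end-l end-z))
        (subst (Linked Adj) reverse-rest (Linked-reverse Adj-sym (Linked.tail (Linked-++⁻ʳ (u ∷ pre) c)))))

    end-l′ : Linked Adj (u ∷ l) → Adj (end l′) z
    end-l′ c = subst (λ w → Adj w z) (sym (cong proj₂ lastTwo-l′)) (Adj-sym (Linked.head (Linked-++⁻ʳ (u ∷ pre) c)))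

    z≢penultimate-l′ : Unique (u ∷ l) → z ≢ penultimate l′
    z≢penultimate-l′ ul z≡pen = proj₂ (unique-middle (u ∷ pre) rest ul) (there (here (trans z≡pen (cong proj₁ lastTwo-l′))))

    l′≢l : Unique (u ∷ l) → l′ ≢ l
    l′≢l ul eq with trans (sym reverse-rest) (∷-injectiveʳ (++-cancelˡ pre (z ∷ reverse rest) (z ∷ rest) eq))
    ... | e∷r≡rest = last≢first r rest≡r∷ʳe (∷-injectiveˡ e∷r≡rest)
      where
      last≢first : ∀ r′ → rest ≡ r′ ∷ʳ e → e ≢ y
      last≢first (_ ∷ r′) rest≡ e≡y with proj₁ (proj₂ (unique-++⁻ (u ∷ pre) ul))
      ... | _ ∷ (y∉ ∷ _) = All¬⇒¬Any y∉ (subst (_∈ (y₂ ∷ r₂)) e≡y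
        (subst (e ∈_) (sym (∷-injectiveʳ rest≡)) (∈-++⁺ʳ r′ (here refl))))

  private
    open-lollipop-split : ∀ pre z rest → length (pre ++ z ∷ rest) ≡ k → OpenLollipop (pre ++ z ∷ rest , z) →
      let l′ = pre ++ z ∷ reverse rest in
      l′ ∈ sequences × OpenLollipop (l′ , z) × pre ++ z ∷ reverse (reverse rest) ≡ pre ++ z ∷ rest × l′ ≢ pre ++ z ∷ rest
    open-lollipop-split pre z [] _ (((_ , c , _) , end-z , _) , _) =
      ⊥-elim (Bool.not-¬ refl (trans (sym (subst (λ w → adj G w z ≡ true) (lastTwo-∷ʳ u u pre z) end-z)) (irrefl G z)))
    open-lollipop-split pre z (y ∷ []) _ ((_ , _ , z≢pen) , _) = ⊥-elim (z≢pen (sym (cong proj₁ (lastTwo-++ u u pre z y))))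
    open-lollipop-split pre z (y ∷ y₂ ∷ r₂) len (((ul , c , hd) , end-z , _) , z≢u) =
      ∈-sequences l′ (trans length-l′ len) ,
      (((unique-l′ ul , linked-l′ c end-z , trans (head-++-∷ pre z (reverse rest) rest) hd) , end-l′ c , z≢penultimate-l′ ul) , z≢u) ,
      cong (λ w → pre ++ z ∷ w) (reverse-involutive rest) , l′≢l ul
      where open Rotation pre z y y₂ r₂

  posa-involution : FreeInvolutionOn OpenLollipop posa markedSequences
  posa-involution (l , z) p∈ open-lollipop@(((ul , _) , _) , z≢u) with ∈-cartesianProduct⁻ sequences (allFin (suc k)) p∈
  ... | l∈ , _ with unique-full⇒∈ (u ∷ l) ul (cong suc (∈-sequences⇒length l∈)) z
  ...   | here z≡u = ⊥-elim (z≢u z≡u)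
  ...   | there z∈ with ∈-∃++ z∈
  ...     | pre , rest , refl
    rewrite reverseAfter-++ Fin._≟_ z pre rest (proj₁ (unique-middle (u ∷ pre) rest ul) ∘ there)
    with open-lollipop-split pre z rest (∈-sequences⇒length l∈) open-lollipop
  ...       | l′∈ , open′ , back , l′≢l
    rewrite reverseAfter-++ Fin._≟_ z pre (reverse rest) (proj₁ (unique-middle (u ∷ pre) rest ul) ∘ there) =
    ∈-cartesianProduct⁺ l′∈ (∈-allFin z) , open′ , cong (_, z) back , l′≢l ∘ cong proj₁

  even-open-lollipops : Even (count OpenLollipop? markedSequences)
  even-open-lollipops = count-even-of-involution OpenLollipop? posa markedSequences
    (Unique.cartesianProduct⁺ (allLists-unique k (allFin (suc k)) (Unique.allFin⁺ (suc k))) (Unique.allFin⁺ (suc k)))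
    posa-involution

  count-neighbours : ∀ a → count (Adj? a) (allFin (suc k)) ≡ 3
  count-neighbours a =
    trans (sym (count-cong (T? ∘ adj G a) (Adj? a) (allFin (suc k)) (λ b _ → Equivalence.to Bool.T-≡ , Equivalence.from Bool.T-≡)))
          (trans (sym (length-filter≡count (T? ∘ adj G a) (allFin (suc k)))) (cubic a))

  penultimate-end : ∀ l {m} → length l ≡ suc m → Linked Adj (u ∷ l) → Adj (penultimate l) (end l)
  penultimate-end l {m} len c = subst₂ Adj (sym (cong proj₁ last-two)) (sym (cong proj₂ last-two))
    (Linked-nth u (u ∷ l) m c (subst (suc m <_) (cong suc (sym len)) ≤-refl))
    where last-two = lastTwo≡nth u u u l len

  private
    k≡1+k∸1 : k ≡ suc (k ∸ 1)
    k≡1+k∸1 = positive 2≤k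
      where
      positive : ∀ {m} → 2 ≤ m → m ≡ suc (m ∸ 1)
      positive (s≤s _) = refl

    lollipops-with-stick : ∀ l → l ∈ sequences → (d : Dec (IsPath l)) →
      count (λ z → d ×-dec Adj? (end l) z ×-dec ¬? (z Fin.≟ penultimate l)) (allFin (suc k)) ≡ indicator d + indicator d
    lollipops-with-stick l _  (no ¬path) =
      count≡0 (λ z → no ¬path ×-dec Adj? (end l) z ×-dec ¬? (z Fin.≟ penultimate l)) (allFin (suc k)) (λ _ _ → ¬path ∘ proj₁)
    lollipops-with-stick l l∈ (yes path@(_ , c , _)) =
      trans (count-cong _ chord? (allFin (suc k)) (λ _ _ → proj₂ , (path ,_))) two-chords
      where
      chord? : ∀ z → Dec (Adj (end l) z × z ≢ penultimate l)
      chord? z = Adj? (end l) z ×-dec ¬? (z Fin.≟ penultimate l)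
      end-penultimate : Adj (end l) (penultimate l)
      end-penultimate = Adj-sym (penultimate-end l (trans (∈-sequences⇒length l∈) k≡1+k∸1) c)
      one-back : count (λ z → Adj? (end l) z ×-dec (z Fin.≟ penultimate l)) (allFin (suc k)) ≡ 1
      one-back = count≡1 _ (allFin (suc k)) (Unique.allFin⁺ (suc k)) (∈-allFin (penultimate l)) (end-penultimate , refl) (λ _ _ → proj₂)
      two-chords : count chord? (allFin (suc k)) ≡ 2
      two-chords = suc-injective (trans (sym (cong (_+ count chord? (allFin (suc k))) one-back))
        (trans (sym (count-split (Adj? (end l)) (λ z → z Fin.≟ penultimate l) (allFin (suc k)))) (count-neighbours (end l))))

  -- Every path ends in a vertex with two neighbours other than its predecessor.
  count-lollipops : count Lollipop? markedSequences ≡ count IsPath? sequences + count IsPath? sequences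
  count-lollipops = begin
    count Lollipop? markedSequences
      ≡⟨ count-cartesianProduct Lollipop? sequences (allFin (suc k)) ⟩
    sum (map (λ l → count (λ z → Lollipop? (l , z)) (allFin (suc k))) sequences)
      ≡⟨ sum-map-cong _ _ sequences (λ l l∈ → lollipops-with-stick l l∈ (IsPath? l)) ⟩
    sum (map (λ l → indicator (IsPath? l) + indicator (IsPath? l)) sequences)
      ≡⟨ sum-map-+ _ _ sequences ⟩
    sum (map (indicator ∘ IsPath?) sequences) + sum (map (indicator ∘ IsPath?) sequences)
      ≡⟨ cong₂ _+_ (sum-map-indicator IsPath? sequences) (sum-map-indicator IsPath? sequences) ⟩
    count IsPath? sequences + count IsPath? sequences ∎
    where open ≡-Reasoning

  count-closing-lollipops : count (λ p → Lollipop? p ×-dec (proj₂ p Fin.≟ u)) markedSequences ≡ count Closable? sequences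
  count-closing-lollipops =
    trans (count-cartesianProduct (λ p → Lollipop? p ×-dec (proj₂ p Fin.≟ u)) sequences (allFin (suc k)))
          (trans (sum-map-cong _ _ sequences (λ l _ → closing-at l)) (sum-map-indicator Closable? sequences))
    where
    closing-at : ∀ l → count (λ z → Lollipop? (l , z) ×-dec (z Fin.≟ u)) (allFin (suc k)) ≡ indicator (Closable? l)
    closing-at l with Closable? l
    ... | yes closable = count≡1 _ (allFin (suc k)) (Unique.allFin⁺ (suc k)) (∈-allFin u) (closable , refl) (λ _ _ → proj₂)
    ... | no ¬closable = count≡0 _ (allFin (suc k)) (λ { _ _ (lollipop , refl) → ¬closable lollipop })

  even-closable-paths : Even (count Closable? sequences)
  even-closable-paths = even-difference (count Closable? sequences) (count OpenLollipop? markedSequences) (count IsPath? sequences)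
    (trans (sym (trans (count-split Lollipop? (λ p → proj₂ p Fin.≟ u) markedSequences) (cong (_+ count OpenLollipop? markedSequences) count-closing-lollipops)))
           count-lollipops)
    even-open-lollipops

  -- Closable sequences and Hamilton cycles through ux

  walk : List (Fin (suc k)) → Fin (suc k) → Fin (suc k)
  walk l i = nth u (u ∷ l) (toℕ i)

  AdjacentIn? : ∀ (ρ : Fin (suc k) → Fin (suc k)) a b → Dec (AdjacentIn ρ a b)
  AdjacentIn? ρ a b = any? (λ i → (ρ i Fin.≟ a) ×-dec ((ρ (next i) Fin.≟ b) ⊎-dec (ρ (prev i) Fin.≟ b)))

  cycleOf : List (Fin (suc k)) → EdgeRel (suc k)
  cycleOf l a b = does (AdjacentIn? (walk l) a b)

  private
    toℕ-next-zero : toℕ (next (zero {k})) ≡ 1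
    toℕ-next-zero with next-cases (zero {k})
    ... | inj₁ (0≡k , _) = ⊥-elim (<-irrefl 0≡k (≤-trans (s≤s z≤n) 2≤k))
    ... | inj₂ (_ , e)   = e

    next-last : next (fromℕ k) ≡ zero
    next-last with next-cases (fromℕ k)
    ... | inj₁ (_ , e)  = e
    ... | inj₂ (k<k , _) = ⊥-elim (<-irrefl (toℕ-fromℕ k) k<k)

    <length : ∀ {l : List (Fin (suc k))} → length l ≡ k → ∀ i → toℕ i < length (u ∷ l)
    <length len i = subst (toℕ i <_) (cong suc (sym len)) (toℕ<n i)

  end≡walk-last : ∀ l → length l ≡ k → end l ≡ walk l (fromℕ k)
  end≡walk-last l len = trans (cong proj₂ (lastTwo≡nth u u u l len)) (cong (nth u (u ∷ l)) (sym (toℕ-fromℕ k)))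

  walk-second : ∀ l → head l ≡ just x → walk l (next zero) ≡ x
  walk-second (y ∷ l) h = trans (cong (nth u (u ∷ y ∷ l)) toℕ-next-zero) (Maybe.just-injective h)

  walk-second⁻ : ∀ l → length l ≡ k → walk l (next zero) ≡ x → head l ≡ just x
  walk-second⁻ []      len _ = ⊥-elim (<-irrefl len (≤-trans (s≤s z≤n) 2≤k))
  walk-second⁻ (y ∷ l) len e = cong just (trans (sym (cong (nth u (u ∷ y ∷ l)) toℕ-next-zero)) e)

  walk-injective : ∀ l → length l ≡ k → Unique (u ∷ l) → Injective _≡_ _≡_ (walk l)
  walk-injective l len ul {i} {j} e = toℕ-injective (nth-injective u (u ∷ l) (toℕ i) (toℕ j) ul (<length {l} len i) (<length {l} len j) e)

  walk-adjacent : ∀ l → length l ≡ k → Closable l → ∀ i → Adj (walk l i) (walk l (next i))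
  walk-adjacent l len ((_ , c , _) , end-u , _) i with next-cases i
  ... | inj₁ (i≡k , n≡0) =
    subst₂ Adj (sym (trans (cong (nth u (u ∷ l)) (trans i≡k (sym (toℕ-fromℕ k)))) (sym (end≡walk-last l len))))
               (sym (cong (walk l) n≡0)) end-u
  ... | inj₂ (i<k , n≡1+i) = subst (λ t → Adj (walk l i) (nth u (u ∷ l) t)) (sym n≡1+i)
    (Linked-nth u (u ∷ l) (toℕ i) c (subst (suc (toℕ i) <_) (cong suc (sym len)) (s≤s i<k)))

  walk⇒Linked : ∀ l → length l ≡ k → (∀ i → Adj (walk l i) (walk l (next i))) → Linked Adj (u ∷ l)
  walk⇒Linked l len walk-adj = nth⇒Linked u (u ∷ l) λ t 1+t<len →
    let t<1+k = subst (t <_) (cong suc len) (ℕ.<-trans (ℕ.n<1+n t) 1+t<len) in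
    subst (λ s → Adj (nth u (u ∷ l) s) (nth u (u ∷ l) (suc s))) (toℕ-fromℕ< t<1+k)
      (step (fromℕ< t<1+k) (subst (λ s → suc s < length (u ∷ l)) (sym (toℕ-fromℕ< t<1+k)) 1+t<len))
    where
    step : ∀ i → suc (toℕ i) < length (u ∷ l) → Adj (walk l i) (nth u (u ∷ l) (suc (toℕ i)))
    step i 1+i<len with next-cases i
    ... | inj₁ (i≡k , _)   = ⊥-elim (<-irrefl i≡k (subst (suc (toℕ i) ≤_) len (ℕ.≤-pred 1+i<len)))
    ... | inj₂ (_ , n≡1+i) = subst (λ s → Adj (walk l i) (nth u (u ∷ l) s)) n≡1+i (walk-adj i)

  AdjacentIn-cong : ∀ {ρ₁ ρ₂ : Fin (suc k) → Fin (suc k)} → (∀ i → ρ₁ i ≡ ρ₂ i) → ∀ {a b} → AdjacentIn ρ₁ a b → AdjacentIn ρ₂ a b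
  AdjacentIn-cong ρ₁≗ρ₂ (i , ρi≡a , adj) =
    i , trans (sym (ρ₁≗ρ₂ i)) ρi≡a , Data.Sum.map (trans (sym (ρ₁≗ρ₂ (next i)))) (trans (sym (ρ₁≗ρ₂ (prev i)))) adj

  private
    does-true : ∀ {X : Set} (d : Dec X) → does d ≡ true → X
    does-true (yes x) _ = x

    true-does : ∀ {X : Set} (d : Dec X) → X → does d ≡ true
    true-does (yes _) _ = refl
    true-does (no ¬x) x = ⊥-elim (¬x x)

    does≡ : ∀ {X : Set} (d : Dec X) (b : Bool) → (X → b ≡ true) → (b ≡ true → X) → does d ≡ b
    does≡ (yes x) b to _    = sym (to x)
    does≡ (no ¬x) true  _ from = ⊥-elim (¬x (from refl))
    does≡ (no ¬x) false _ _    = refl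

  cycleOf-hamiltonian : ∀ l → l ∈ sequences → Closable l → IsHamCycle G (cycleOf l) × cycleOf l u x ≡ true
  cycleOf-hamiltonian l l∈ closable@((ul , _ , hd) , _) =
    (s≤s 2≤k , ⊆adj , walk l , walk-injective l len ul , cycle⇒succ , succ⇒cycle) ,
    true-does (AdjacentIn? (walk l) u x) (zero , refl , inj₁ (walk-second l hd))
    where
    len : length l ≡ k
    len = ∈-sequences⇒length l∈
    ρ : Fin (suc k) → Fin (suc k)
    ρ = walk l
    ⊆adj : ∀ a b → cycleOf l a b ≡ true → Adj a b
    ⊆adj a b r with does-true (AdjacentIn? ρ a b) r
    ... | i , refl , inj₁ refl = walk-adjacent l len closable i
    ... | i , refl , inj₂ refl = Adj-sym (subst (λ w → Adj (ρ (prev i)) (ρ w)) (next-prev i) (walk-adjacent l len closable (prev i)))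
    cycle⇒succ : ∀ a b → cycleOf l a b ≡ true →
      ∃[ i ] ∃[ j ] (CyclicSucc (suc k) i j × (((ρ i ≡ a) × (ρ j ≡ b)) ⊎ ((ρ i ≡ b) × (ρ j ≡ a))))
    cycle⇒succ a b r with does-true (AdjacentIn? ρ a b) r
    ... | i , ρi≡a , inj₁ ρni≡b = i , next i , next→CyclicSucc i , inj₁ (ρi≡a , ρni≡b)
    ... | i , ρi≡a , inj₂ ρpi≡b = prev i , i , subst (CyclicSucc (suc k) (prev i)) (next-prev i) (next→CyclicSucc (prev i)) , inj₂ (ρpi≡b , ρi≡a)
    succ⇒cycle : ∀ i j → CyclicSucc (suc k) i j → cycleOf l (ρ i) (ρ j) ≡ true × cycleOf l (ρ j) (ρ i) ≡ true
    succ⇒cycle i j succ =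
      true-does (AdjacentIn? ρ (ρ i) (ρ j)) (i , refl , inj₁ (cong ρ (sym j≡ni))) ,
      true-does (AdjacentIn? ρ (ρ j) (ρ i)) (j , refl , inj₂ (cong ρ (trans (cong prev j≡ni) (prev-next i))))
      where j≡ni = CyclicSucc→next succ

  -- A closed walk through u and then x is determined by its edge set.
  cycleOf-injective : ∀ l l′ → l ∈ sequences → l′ ∈ sequences → Closable l → Closable l′ →
    (∀ a b → cycleOf l a b ≡ cycleOf l′ a b) → l ≡ l′
  cycleOf-injective l l′ l∈ l′∈ ((ul , _ , hd) , _) ((ul′ , _ , hd′) , _) same =
    nth-ext u l l′ (trans len (sym len′)) λ t t<len →
      let t<1+k = s≤s (subst (t <_) len t<len) in
      subst (λ s → nth u (u ∷ l) s ≡ nth u (u ∷ l′) s) (toℕ-fromℕ< t<1+k) (walks-agree (fromℕ< t<1+k))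
    where
    len : length l ≡ k
    len = ∈-sequences⇒length l∈
    len′ : length l′ ≡ k
    len′ = ∈-sequences⇒length l′∈
    ρ ρ′ : Fin (suc k) → Fin (suc k)
    ρ = walk l
    ρ′ = walk l′
    transport : ∀ {a b} → AdjacentIn ρ a b → AdjacentIn ρ′ a b
    transport {a} {b} adj = does-true (AdjacentIn? ρ′ a b) (trans (sym (same a b)) (true-does (AdjacentIn? ρ a b) adj))
    Agree : Fin (suc k) → Set
    Agree i = ρ i ≡ ρ′ i × ρ (next i) ≡ ρ′ (next i)
    step : ∀ i → Agree i → Agree (next i)
    step i (ρi≡ , ρni≡) = ρni≡ , forward (AdjacentIn-at (walk-injective l′ len′ ul′) {j = next i} (sym ρni≡) (transport (next i , refl , inj₁ refl)))
      where
      forward : ρ′ (next (next i)) ≡ ρ (next (next i)) ⊎ ρ′ (prev (next i)) ≡ ρ (next (next i)) → ρ (next (next i)) ≡ ρ′ (next (next i))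
      forward (inj₁ e) = sym e
      forward (inj₂ e) = ⊥-elim (next²≢id 2≤k i (sym (walk-injective l len ul (trans ρi≡ (trans (sym (cong ρ′ (prev-next i))) e)))))
    agree : ∀ t → Agree (rotate t zero)
    agree zero    = refl , trans (walk-second l hd) (sym (walk-second l′ hd′))
    agree (suc t) = step (rotate t zero) (agree t)
    walks-agree : ∀ i → ρ i ≡ ρ′ i
    walks-agree i = subst (λ w → ρ w ≡ ρ′ w) (rotate-toℕ-zero i) (proj₁ (agree (toℕ i)))

  cycleOf-surjective : ∀ D → IsHamCycle G D → D u x ≡ true → ∃[ l ] l ∈ sequences × Closable l × (∀ a b → cycleOf l a b ≡ D a b)
  cycleOf-surjective D hc dux with traversal-along {G = G} hc u x dux
  ... | ρ , (ρ-inj , D⇒adj , adj⇒D) , ρ0≡u , ρ1≡x =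
    l , ∈-sequences l len , ((unique , walk⇒Linked l len cyclic , walk-second⁻ l len (trans (walk≡ρ (next zero)) ρ1≡x)) , end-u , u≢pen) , same
    where
    l : List (Fin (suc k))
    l = tabulate (ρ ∘ suc)
    len : length l ≡ k
    len = length-tabulate (ρ ∘ suc)
    walk≡ρ : ∀ i → walk l i ≡ ρ i
    walk≡ρ zero    = sym ρ0≡u
    walk≡ρ (suc j) = nth-tabulate (ρ ∘ suc) j
      where
      nth-tabulate : ∀ {m} (f : Fin m → Fin (suc k)) j → nth u (tabulate f) (toℕ j) ≡ f j
      nth-tabulate f zero    = refl
      nth-tabulate f (suc j) = nth-tabulate (f ∘ suc) j
    same : ∀ a b → cycleOf l a b ≡ D a b
    same a b = does≡ (AdjacentIn? (walk l) a b) (D a b) (adj⇒D a b ∘ AdjacentIn-cong walk≡ρ) (AdjacentIn-cong (sym ∘ walk≡ρ) ∘ D⇒adj a b)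
    cyclic : ∀ i → Adj (walk l i) (walk l (next i))
    cyclic i = subst₂ Adj (sym (walk≡ρ i)) (sym (walk≡ρ (next i))) (proj₁ (proj₂ hc) _ _ (adj⇒D _ _ (i , refl , inj₁ refl)))
    unique : Unique (u ∷ l)
    unique = subst (λ w → Unique (w ∷ l)) ρ0≡u (Unique.tabulate⁺ ρ-inj)
    end-u : Adj (end l) u
    end-u = subst₂ Adj (sym (end≡walk-last l len)) (cong (walk l) next-last) (cyclic (fromℕ k))
    k∸1<1+k : k ∸ 1 < suc k
    k∸1<1+k = s≤s (ℕ.m∸n≤m k 1)
    u≢pen : u ≢ penultimate l
    u≢pen u≡pen = <-irrefl (trans (cong toℕ (ρ-inj (trans ρ0≡u (trans u≡pen (trans pen≡ (walk≡ρ (fromℕ< k∸1<1+k))))))) (toℕ-fromℕ< k∸1<1+k))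
                           (0<k∸1 2≤k)
      where
      0<k∸1 : ∀ {m} → 2 ≤ m → 0 < m ∸ 1
      0<k∸1 (s≤s (s≤s _)) = s≤s z≤n
      pen≡ : penultimate l ≡ walk l (fromℕ< k∸1<1+k)
      pen≡ = trans (cong proj₁ (lastTwo≡nth u u u l (trans len k≡1+k∸1))) (cong (nth u (u ∷ l)) (sym (toℕ-fromℕ< k∸1<1+k)))

edgeRelSetoid : ℕ → Setoid 0ℓ 0ℓ
edgeRelSetoid n = record
  { Carrier       = EdgeRel n
  ; _≈_           = Pointwise (Pointwise _≡_)
  ; isEquivalence = record
    { refl  = λ _ _ → refl
    ; sym   = λ D≈D′ a b → sym (D≈D′ a b)
    ; trans = λ D≈D′ D′≈D″ a b → trans (D≈D′ a b) (D′≈D″ a b)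
    }
  }

allEdgeRels-complete : ∀ n (D : EdgeRel n) → Any (Pointwise (Pointwise _≡_) D) (allEdgeRels n)
allEdgeRels-complete n = allFuns-complete (Pointwise _≡_) n _ (allFuns-complete _≡_ n (true ∷ false ∷ []) Bool-in)
  where
  Bool-in : ∀ b → b ∈ true ∷ false ∷ []
  Bool-in true  = here refl
  Bool-in false = there (here refl)

allEdgeRels-unique : ∀ n → AllPairs (λ D D′ → ¬ Pointwise (Pointwise _≡_) D D′) (allEdgeRels n)
allEdgeRels-unique n = allFuns-unique (Pointwise _≡_) n _ (allFuns-unique _≡_ n (true ∷ false ∷ []) (((λ ()) ∷ []) ∷ [] ∷ []))

IsHamCycle-resp : ∀ {n} {G : SimpleGraph n} {D D′} → Pointwise (Pointwise _≡_) D D′ → IsHamCycle G D → IsHamCycle G D′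
IsHamCycle-resp D≈D′ (3≤n , ⊆adj , σ , σ-inj , D⇒succ , succ⇒D) =
  3≤n , (λ a b d → ⊆adj a b (trans (D≈D′ a b) d)) , σ , σ-inj , (λ a b d → D⇒succ a b (trans (D≈D′ a b) d)) ,
  (λ i j succ → Data.Product.map (trans (sym (D≈D′ _ _))) (trans (sym (D≈D′ _ _))) (succ⇒D i j succ))

even-hamilton-cycles-through : ∀ {k} (G : SimpleGraph (suc k)) → Cubic G → 2 ≤ k → ∀ u x →
  (hc? : ∀ D → Dec (IsHamCycle G D)) → Even (count (λ D → hc? D ×-dec (D u x Bool.≟ true)) (allEdgeRels (suc k)))
even-hamilton-cycles-through {k} G cubic 2≤k u x hc? = subst Even
  (count-≡-of-bijection (edgeRelSetoid (suc k)) Closable? (λ D → hc? D ×-dec (D u x Bool.≟ true)) sequences (allEdgeRels (suc k)) cycleOf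
    (allLists-unique k (allFin (suc k)) (Unique.allFin⁺ (suc k))) (allEdgeRels-unique (suc k))
    (λ D≈D′ (hc , d) → IsHamCycle-resp {G = G} D≈D′ hc , trans (sym (D≈D′ u x)) d)
    (allEdgeRels-complete (suc k))
    cycleOf-hamiltonian cycleOf-injective
    (λ D _ (hc , dux) → cycleOf-surjective D hc dux))
  even-closable-paths
  where open Lollipops G cubic 2≤k u x

-- Degrees of the Hamilton incidence multigraph

module IncidenceDegrees {k : ℕ} (G : SimpleGraph (suc k)) (cubic : Cubic G) (2≤k : 2 ≤ k)
                        (hc? : ∀ D → Dec (IsHamCycle G D)) where

  Adj : Fin (suc k) → Fin (suc k) → Set
  Adj a b = adj G a b ≡ true

  neighbours : Fin (suc k) → List (Fin (suc k))
  neighbours u = filter (T? ∘ adj G u) (allFin (suc k))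

  ∈-neighbours : ∀ {u y} → Adj u y → y ∈ neighbours u
  ∈-neighbours {u} {y} uy = ∈-filter⁺ (T? ∘ adj G u) (∈-allFin y) (Equivalence.from Bool.T-≡ uy)

  third-neighbour : ∀ {u a b} → Adj u a → Adj u b → a ≢ b →
    ∃[ c ] Adj u c × c ≢ a × c ≢ b × (∀ y → Adj u y → y ≡ a ⊎ y ≡ b ⊎ y ≡ c)
  third-neighbour {u} {a} {b} ua ub a≢b with Any.any? (λ c → ¬? (c Fin.≟ a) ×-dec ¬? (c Fin.≟ b)) (neighbours u)
  ... | no none = ⊥-elim (<-irrefl refl (subst (_≤ 2) (cubic u)
        (unique-⊆⇒length≤ (setoid _) (neighbours u) (a ∷ b ∷ []) (Unique.filter⁺ (T? ∘ adj G u) (Unique.allFin⁺ (suc k))) (All.tabulate a-or-b))))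
    where
    a-or-b : ∀ {y} → y ∈ neighbours u → y ∈ a ∷ b ∷ []
    a-or-b {y} y∈ with y Fin.≟ a | y Fin.≟ b
    ... | yes y≡a | _       = here y≡a
    ... | no _    | yes y≡b = there (here y≡b)
    ... | no y≢a  | no y≢b  = ⊥-elim (none (Any.map (λ { refl → y≢a , y≢b }) y∈))
  ... | yes some with Membership.find some
  ...   | c , c∈ , c≢a , c≢b = c , uc , c≢a , c≢b , classify
    where
    uc : Adj u c
    uc = Equivalence.to Bool.T-≡ (proj₂ (∈-filter⁻ (T? ∘ adj G u) {xs = allFin (suc k)} c∈))
    classify : ∀ y → Adj u y → y ≡ a ⊎ y ≡ b ⊎ y ≡ c
    classify y uy with y Fin.≟ a | y Fin.≟ b | y Fin.≟ c
    ... | yes y≡a | _       | _       = inj₁ y≡a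
    ... | no _    | yes y≡b | _       = inj₂ (inj₁ y≡b)
    ... | no _    | no _    | yes y≡c = inj₂ (inj₂ y≡c)
    ... | no y≢a  | no y≢b  | no y≢c  = ⊥-elim (<-irrefl refl (subst (4 ≤_) (cubic u)
            (unique-⊆⇒length≤ (setoid _) (y ∷ a ∷ b ∷ c ∷ []) (neighbours u)
              ((y≢a ∷ y≢b ∷ y≢c ∷ []) ∷ (a≢b ∷ (c≢a ∘ sym) ∷ []) ∷ ((c≢b ∘ sym) ∷ []) ∷ [] ∷ [])
              (∈-neighbours uy ∷ ∈-neighbours ua ∷ ∈-neighbours ub ∷ ∈-neighbours uc ∷ []))))

  UsesPair : Fin (suc k) → Fin (suc k) × Fin (suc k) → EdgeRel (suc k) → Set
  UsesPair u q D = D u (proj₁ q) ≡ true × D u (proj₂ q) ≡ true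

  UsesPair? : ∀ u q D → Dec (UsesPair u q D)
  UsesPair? u q D = (D u (proj₁ q) Bool.≟ true) ×-dec (D u (proj₂ q) Bool.≟ true)

  private
    IsEdgePair? : ∀ u (q : Fin (suc k) × Fin (suc k)) → Dec _
    IsEdgePair? u (c , d) = T? (adj G u c ∧ adj G u d ∧ (toℕ c <ᵇ toℕ d))

  ∈-edgePairs⁻ : ∀ {u c d} → (c , d) ∈ edgePairs G u → Adj u c × Adj u d × toℕ c < toℕ d
  ∈-edgePairs⁻ {u} {c} {d} q∈ with Equivalence.to Bool.T-∧ (proj₂ (∈-filter⁻ (IsEdgePair? u) {xs = cartesianProduct (allFin (suc k)) (allFin (suc k))} q∈))
  ... | uc , rest with Equivalence.to Bool.T-∧ rest
  ...   | ud , c<d = Equivalence.to Bool.T-≡ uc , Equivalence.to Bool.T-≡ ud , ℕ.<ᵇ⇒< (toℕ c) (toℕ d) c<d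

  ∈-edgePairs⁺ : ∀ {u c d} → Adj u c → Adj u d → toℕ c < toℕ d → (c , d) ∈ edgePairs G u
  ∈-edgePairs⁺ {u} {c} {d} uc ud c<d = ∈-filter⁺ (IsEdgePair? u) (∈-cartesianProduct⁺ (∈-allFin c) (∈-allFin d))
    (Equivalence.from Bool.T-∧ (Equivalence.from Bool.T-≡ uc , Equivalence.from Bool.T-∧ (Equivalence.from Bool.T-≡ ud , ℕ.<⇒<ᵇ c<d)))

  edgePairs-unique : ∀ u → Unique (edgePairs G u)
  edgePairs-unique u = Unique.filter⁺ (IsEdgePair? u) (Unique.cartesianProduct⁺ (Unique.allFin⁺ (suc k)) (Unique.allFin⁺ (suc k)))

  private
    pair-used-once-ordered : ∀ u {D} → IsHamCycle G D → ∀ {c d} → toℕ c < toℕ d → D u c ≡ true → D u d ≡ true →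
      (∀ y → D u y ≡ true → y ≡ c ⊎ y ≡ d) → count (λ q → UsesPair? u q D) (edgePairs G u) ≡ 1
    pair-used-once-ordered u {D} hc {c} {d} c<d dc dd only =
      count≡1 (λ q → UsesPair? u q D) (edgePairs G u) (edgePairs-unique u) (∈-edgePairs⁺ (⊆adj u c dc) (⊆adj u d dd) c<d) (dc , dd) same
      where
      ⊆adj : ∀ a b → D a b ≡ true → Adj a b
      ⊆adj = proj₁ (proj₂ hc)
      same : ∀ q → q ∈ edgePairs G u → UsesPair u q D → q ≡ (c , d)
      same (c′ , d′) q∈ (dc′ , dd′) with proj₂ (proj₂ (∈-edgePairs⁻ q∈)) | only c′ dc′ | only d′ dd′
      ... | c′<d′ | inj₁ refl | inj₁ refl = ⊥-elim (<-irrefl refl c′<d′)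
      ... | c′<d′ | inj₂ refl | inj₂ refl = ⊥-elim (<-irrefl refl c′<d′)
      ... | _     | inj₁ refl | inj₂ refl = refl
      ... | c′<d′ | inj₂ refl | inj₁ refl = ⊥-elim (ℕ.<-asym c<d c′<d′)

  pair-used-once : ∀ u {D} → IsHamCycle G D → count (λ q → UsesPair? u q D) (edgePairs G u) ≡ 1
  pair-used-once u {D} hc with two-neighbours {G = G} hc 2≤k u
  ... | y₁ , y₂ , y₁≢y₂ , d₁ , d₂ , only with ℕ.<-cmp (toℕ y₁) (toℕ y₂)
  ...   | tri< y₁<y₂ _ _ = pair-used-once-ordered u hc y₁<y₂ d₁ d₂ only
  ...   | tri≈ _ y₁≡y₂ _ = ⊥-elim (y₁≢y₂ (toℕ-injective y₁≡y₂))
  ...   | tri> _ _ y₂<y₁ = pair-used-once-ordered u hc y₂<y₁ d₂ d₁ (λ y d → Data.Sum.swap (only y d))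

  private
    no-three-among-two : ∀ {y₁ y₂ a b c : Fin (suc k)} → a ≢ b → c ≢ a → c ≢ b →
      (a ≡ y₁ ⊎ a ≡ y₂) → (b ≡ y₁ ⊎ b ≡ y₂) → (c ≡ y₁ ⊎ c ≡ y₂) → ⊥
    no-three-among-two a≢b c≢a c≢b (inj₁ refl) (inj₁ refl) _          = a≢b refl
    no-three-among-two a≢b c≢a c≢b (inj₂ refl) (inj₂ refl) _          = a≢b refl
    no-three-among-two a≢b c≢a c≢b (inj₁ refl) (inj₂ refl) (inj₁ refl) = c≢a refl
    no-three-among-two a≢b c≢a c≢b (inj₁ refl) (inj₂ refl) (inj₂ refl) = c≢b refl
    no-three-among-two a≢b c≢a c≢b (inj₂ refl) (inj₁ refl) (inj₁ refl) = c≢b refl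
    no-three-among-two a≢b c≢a c≢b (inj₂ refl) (inj₁ refl) (inj₂ refl) = c≢a refl

  uses-pair⇔avoids-third : ∀ {u a b c D} → IsHamCycle G D → a ≢ b → c ≢ a → c ≢ b →
    (∀ y → Adj u y → y ≡ a ⊎ y ≡ b ⊎ y ≡ c) → (D u a ≡ true × D u b ≡ true) ⇔ (D u c ≢ true)
  uses-pair⇔avoids-third {u} {a} {b} {c} {D} hc a≢b c≢a c≢b classify with two-neighbours {G = G} hc 2≤k u
  ... | y₁ , y₂ , y₁≢y₂ , d₁ , d₂ , only = mk⇔
    (λ (da , db) dc → no-three-among-two a≢b c≢a c≢b (only a da) (only b db) (only c dc))
    (λ ¬dc → both (a-or-b ¬dc y₁ d₁) (a-or-b ¬dc y₂ d₂))
    where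
    a-or-b : D u c ≢ true → ∀ y → D u y ≡ true → y ≡ a ⊎ y ≡ b
    a-or-b ¬dc y dy with classify y (proj₁ (proj₂ hc) u y dy)
    ... | inj₁ y≡a        = inj₁ y≡a
    ... | inj₂ (inj₁ y≡b) = inj₂ y≡b
    ... | inj₂ (inj₂ refl) = ⊥-elim (¬dc dy)
    both : (y₁ ≡ a ⊎ y₁ ≡ b) → (y₂ ≡ a ⊎ y₂ ≡ b) → D u a ≡ true × D u b ≡ true
    both (inj₁ refl) (inj₁ refl) = ⊥-elim (y₁≢y₂ refl)
    both (inj₂ refl) (inj₂ refl) = ⊥-elim (y₁≢y₂ refl)
    both (inj₁ refl) (inj₂ refl) = d₁ , d₂
    both (inj₂ refl) (inj₁ refl) = d₂ , d₁

  edgeRels : List (EdgeRel (suc k))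
  edgeRels = allEdgeRels (suc k)

  ThroughPair? : ∀ u q D → Dec (IsHamCycle G D × UsesPair u q D)
  ThroughPair? u q D = hc? D ×-dec UsesPair? u q D

  even-+-%2 : ∀ {e} x → Even e → (e + x) % 2 ≡ x % 2
  even-+-%2 x (d , refl) = trans (cong (_% 2) (trans (+-comm (d + d) x) (cong (x +_) d+d≡d*2))) ([m+kn]%n≡m%n x d 2)
    where
    d+d≡d*2 : d + d ≡ d * 2
    d+d≡d*2 = trans (cong (d +_) (sym (+-identityʳ d))) (*-comm 2 d)

  through-pair-parity : ∀ u {a b} → (a , b) ∈ edgePairs G u → count (ThroughPair? u (a , b)) edgeRels % 2 ≡ count hc? edgeRels % 2
  through-pair-parity u {a} {b} q∈ with ∈-edgePairs⁻ q∈
  ... | ua , ub , a<b with third-neighbour ua ub (λ { refl → <-irrefl refl a<b })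
  ...   | c , uc , c≢a , c≢b , classify = begin
    count (ThroughPair? u (a , b)) edgeRels % 2
      ≡⟨ sym (even-+-%2 _ (even-hamilton-cycles-through G cubic 2≤k u c hc?)) ⟩
    (count (λ D → hc? D ×-dec (D u c Bool.≟ true)) edgeRels + count (ThroughPair? u (a , b)) edgeRels) % 2
      ≡⟨ cong (λ m → (count (λ D → hc? D ×-dec (D u c Bool.≟ true)) edgeRels + m) % 2) (count-cong _ _ edgeRels avoids⇔uses) ⟩
    (count (λ D → hc? D ×-dec (D u c Bool.≟ true)) edgeRels + count (λ D → hc? D ×-dec ¬? (D u c Bool.≟ true)) edgeRels) % 2
      ≡⟨ cong (_% 2) (sym (count-split hc? (λ D → D u c Bool.≟ true) edgeRels)) ⟩
    count hc? edgeRels % 2 ∎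
    where
    open ≡-Reasoning
    avoids⇔uses : ∀ D → D ∈ edgeRels → (IsHamCycle G D × UsesPair u (a , b) D → IsHamCycle G D × D u c ≢ true) ×
                                         (IsHamCycle G D × D u c ≢ true → IsHamCycle G D × UsesPair u (a , b) D)
    avoids⇔uses D _ = (λ (hc , uses) → hc , Equivalence.to (uses-pair⇔avoids-third hc (λ { refl → <-irrefl refl a<b }) c≢a c≢b classify) uses) ,
                      (λ (hc , avoids) → hc , Equivalence.from (uses-pair⇔avoids-third hc (λ { refl → <-irrefl refl a<b }) c≢a c≢b classify) avoids)

  module _ (v w : Fin (suc k)) where
    open Hamilton G v w hc?

    -- Double counting: each Hamilton cycle uses exactly one pair of edges at w (resp. v).
    degV≡ : ∀ a b → degV (a , b) ≡ count (ThroughPair? v (a , b)) edgeRels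
    degV≡ a b =
      trans (sum-map-cong _ (λ q → count (λ D → ThroughPair? v (a , b) D ×-dec UsesPair? w q D) edgeRels) (edgePairs G w) mult≡)
            (double-counting (ThroughPair? v (a , b)) (UsesPair? w) edgeRels (edgePairs G w) (λ D _ → pair-used-once w ∘ proj₁))
      where
      mult≡ : ∀ q → q ∈ edgePairs G w → mult (a , b) q ≡ count (λ D → ThroughPair? v (a , b) D ×-dec UsesPair? w q D) edgeRels
      mult≡ (c , d) _ = trans (length-filter≡count _ edgeRels) (count-cong _ _ edgeRels (λ D _ →
        (λ (h , e₁ , e₂ , e₃ , e₄) → (h , e₁ , e₂) , (e₃ , e₄)) , (λ ((h , e₁ , e₂) , (e₃ , e₄)) → h , e₁ , e₂ , e₃ , e₄)))

    degW≡ : ∀ c d → degW (c , d) ≡ count (ThroughPair? w (c , d)) edgeRels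
    degW≡ c d =
      trans (sum-map-cong _ (λ p → count (λ D → ThroughPair? w (c , d) D ×-dec UsesPair? v p D) edgeRels) (edgePairs G v) mult≡)
            (double-counting (ThroughPair? w (c , d)) (UsesPair? v) edgeRels (edgePairs G v) (λ D _ → pair-used-once v ∘ proj₁))
      where
      mult≡ : ∀ p → p ∈ edgePairs G v → mult p (c , d) ≡ count (λ D → ThroughPair? w (c , d) D ×-dec UsesPair? v p D) edgeRels
      mult≡ (a , b) _ = trans (length-filter≡count _ edgeRels) (count-cong _ _ edgeRels (λ D _ →
        (λ (h , e₁ , e₂ , e₃ , e₄) → (h , e₃ , e₄) , (e₁ , e₂)) , (λ ((h , e₃ , e₄) , (e₁ , e₂)) → h , e₁ , e₂ , e₃ , e₄)))

    hDegree-parity : ∀ z → z ∈ hDegrees → z % 2 ≡ count hc? edgeRels % 2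
    hDegree-parity z z∈ with ∈-++⁻ (map degV (edgePairs G v)) z∈
    ... | inj₁ z∈V with ∈-map⁻ degV z∈V
    ...   | (a , b) , p∈ , refl = trans (cong (_% 2) (degV≡ a b)) (through-pair-parity v p∈)
    hDegree-parity z z∈ | inj₂ z∈W with ∈-map⁻ degW z∈W
    ...   | (c , d) , q∈ , refl = trans (cong (_% 2) (degW≡ c d)) (through-pair-parity w q∈)

cubic⇒3≤n : ∀ {n} (G : SimpleGraph n) → Cubic G → Fin n → 3 ≤ n
cubic⇒3≤n {n} G cubic v = subst₂ _≤_ (cubic v) (length-tabulate (λ i → i)) (length-filter (T? ∘ adj G v) (allFin n))

lemma3p4 : ∀ {n} (G : SimpleGraph n) → Cubic G → (v w : Fin n) → ¬ (v ≡ w) →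
    (hc? : ∀ D → Dec (IsHamCycle G D)) →
    ∀ x y → x ∈ Hamilton.hDegrees G v w hc? → y ∈ Hamilton.hDegrees G v w hc? →
    x % 2 ≡ y % 2
lemma3p4 {n} G cubic v w _ hc? x y x∈ y∈ with cubic⇒3≤n G cubic v
... | s≤s 2≤k = trans (parity x x∈) (sym (parity y y∈))
  where parity = IncidenceDegrees.hDegree-parity G cubic 2≤k hc? v w
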